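{- There is an absolute constant $K>0$ such that the following holds. Let $f:\{0,1\}^n\to\{0,1\}$ be an arbitrary Boolean function, let $H$ be any probability distribution over $\{0,1\}^n$, and let $\gamma\in\left(\tfrac{27}{2^{n/2}},\tfrac12\right)$. Let $G:\{0,1\}^m\to\{0,1\}^{2^n}$ be a $4$-wise uniform generator (with output coordinates indexed by $x\in\{0,1\}^n$) such that for each $s\in\{0,1\}^m$ there exists a circuit $C_s$ of size $r$ with $C_s(x)=G(s)_x$ for all $x\in\{0,1\}^n$. Then there exists a circuit $C$ of size at most $K\left(\frac{\gamma^2 2^n}{\log(\gamma^2 2^n)}+r\right)$ such that $\Pr_{x\sim H}[C(x)=f(x)]\ge\tfrac12+\gamma$.
   Context: A distribution $D$ over $\{0,1\}^N$ is $k$-wise uniform if for every set $T$ of $k$ coordinates, the marginal distribution of $x_T$ for $x\sim D$ is uniform over $\{0,1\}^k$. A function $G:S\to\{0,1\}^N$ is a $k$-wise uniform generator if the distribution of $G(s)$ for $s$ uniform in $S$ is $k$-wise uniform. Circuits have gates computing arbitrary Boolean functions of fan-in 2, arbitrary depth, and size is the number of gates. Logarithms are base 2.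
   Formalization: The parameter γ and the probabilities of the distribution H take rational values. -}

module Defs where

open import Data.Bool using (Bool; true; false; if_then_else_)
open import Data.Bool.Properties using () renaming (_≟_ to _≟ᵇ_)
open import Data.Nat as ℕ using (ℕ; zero; suc)
open import Data.Integer using (ℤ; +_; ∣_∣)
open import Data.Fin using (Fin; zero; suc)
open import Data.Vec using (Vec; []; _∷_; lookup)
open import Data.List using (List; []; _∷_; map; _++_; foldr; length; filterᵇ; allFin)
open import Data.Bool.ListAction using (and)
open import Data.Rational as ℚ using (ℚ; 0ℚ; 1ℚ; ↥_; ↧ₙ_)
open import Data.Product using (_×_)
open import Function.Definitions using (Injective)
open import Relation.Nullary.Decidable using (⌊_⌋)
open import Relation.Binary.PropositionalEquality using (_≡_)

BitStr : ℕ → Set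
BitStr n = Vec Bool n

allBitStr : (n : ℕ) → List (BitStr n)
allBitStr zero    = [] ∷ []
allBitStr (suc n) = map (false ∷_) (allBitStr n) ++ map (true ∷_) (allBitStr n)

record Gate (m : ℕ) : Set where
  constructor gate
  field
    op  : Bool → Bool → Bool
    in₁ : Fin m
    in₂ : Fin m

-- Gates n k : a sequence of k gates over n inputs; the i-th gate may read
-- the n inputs and all previously computed gates (arbitrary depth).
data Gates (n : ℕ) : ℕ → Set where
  []  : Gates n 0
  _▷_ : ∀ {k} → Gates n k → Gate (k ℕ.+ n) → Gates n (suc k)

-- values of all wires (newest gate first, inputs last)
wires : ∀ {n k} → Gates n k → BitStr n → Vec Bool (k ℕ.+ n)
wires []       x = x
wires (gs ▷ g) x = let w = wires gs x in
  Gate.op g (lookup w (Gate.in₁ g)) (lookup w (Gate.in₂ g)) ∷ w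

record Circuit (n : ℕ) : Set where
  constructor circuit
  field
    size  : ℕ
    gates : Gates n size
    out   : Fin (size ℕ.+ n)

eval : ∀ {n} → Circuit n → BitStr n → Bool
eval C x = lookup (wires (Circuit.gates C) x) (Circuit.out C)

Computes : ∀ {n} → Circuit n → (BitStr n → Bool) → Set
Computes C h = ∀ x → eval C x ≡ h x

sumℚ : List ℚ → ℚ
sumℚ = foldr ℚ._+_ 0ℚ

record Distribution (n : ℕ) : Set where
  field
    weight    : BitStr n → ℚ
    nonneg    : ∀ x → 0ℚ ℚ.≤ weight x
    sums-to-1 : sumℚ (map weight (allBitStr n)) ≡ 1ℚ

PrAgree : ∀ {n} → Distribution n → Circuit n → (BitStr n → Bool) → ℚ
PrAgree {n} H C f =
  sumℚ (map (λ x → if ⌊ eval C x ≟ᵇ f x ⌋ then Distribution.weight H x else 0ℚ)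
            (allBitStr n))

agreesOn : ∀ {k} {I : Set} → (I → Bool) → (Fin k → I) → (Fin k → Bool) → Bool
agreesOn {k} y T b = and (map (λ i → ⌊ y (T i) ≟ᵇ b i ⌋) (allFin k))

KWiseUniformGen : (k m : ℕ) {I : Set} → (BitStr m → I → Bool) → Set
KWiseUniformGen k m G =
  ∀ (T : Fin k → _) → Injective _≡_ _≡_ T → ∀ (b : Fin k → Bool) →
    length (filterᵇ (λ s → agreesOn (G s) T b) (allBitStr m)) ℕ.* 2 ℕ.^ k
      ≡ 2 ℕ.^ m

_^ℚ_ : ℚ → ℕ → ℚ
q ^ℚ zero  = 1ℚ
q ^ℚ suc e = q ℚ.* (q ^ℚ e)

-- y ≤ 2^q for a rational exponent q = p/d ≥ 0 (lowest terms) and y ≥ 0,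
-- i.e. y^d ≤ 2^p.
_≤2^_ : ℚ → ℚ → Set
y ≤2^ q = (y ^ℚ (↧ₙ q)) ℚ.≤ ((+ 2 ℚ./ 1) ^ℚ ∣ ↥ q ∣)

-- d · log₂ A ≤ B  (for A > 0, B ≥ 0), i.e. log₂ (A^d) ≤ B, i.e. A^d ≤ 2^B.
MulLog2≤ : ℕ → ℚ → ℚ → Set
MulLog2≤ d A B = (A ^ℚ d) ≤2^ B

-- size ≤ K · (A / log₂ A + r)   for A > 1, K ≥ 1:
-- equivalently (size − K r) · log₂ A ≤ K · A  (trivial when size ≤ K r,
-- where the truncated difference is 0).
SizeBound : (K : ℕ) (A : ℚ) (r size : ℕ) → Set
SizeBound K A r size = MulLog2≤ (size ℕ.∸ K ℕ.* r) A ((+ K ℚ./ 1) ℚ.* A)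

-- Let χₛ(x) = ±1 according as G(s)ₓ = f(x), cut {0,1}ⁿ into the 2ᵏ blocks B_β = {β ++ y},
-- 2ᵏ ≈ 12γ²2ⁿ, and let X_β(s) = Σ_{x ∈ B_β} H(x) χₛ(x). The circuit x ↦ G(s)ₓ ⊕ [X_{β(x)}(s) < 0]
-- agrees with f with probability ½(1 + Σ_β |X_β(s)|). Four-wise uniformity makes the χₛ(x) behave
-- like independent signs up to fourth moments: E X_β² = Σ_{B_β} H² and E X_β⁴ ≤ 3 (Σ_{B_β} H²)²,
-- hence E|X_β| ≥ (Σ_{B_β} H² / 3)^½ ≥ H(B_β) / (3 |B_β|)^½, and summing over the blocks some seed
-- has Σ_β |X_β(s)| ≥ 2γ. The correction β ↦ [X_β(s) < 0] is an arbitrary function of k bits, which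
-- costs O(2ᵏ/k) = O(γ²2ⁿ / log(γ²2ⁿ)) gates: tabulate all functions of the last q ≈ log₂ k bits and
-- multiplex on the others. When 12γ² > 1, take k = n and correct G(s) to f itself.

module Submission where

open import Level using (0ℓ)
open import Algebra.Bundles using (CommutativeMonoid)
open import Data.Bool using (Bool; true; false; not; _∧_; _∨_; _xor_; if_then_else_)
open import Data.Bool.ListAction using (and)
open import Data.Bool.Properties using (not-¬; ∨-identityʳ; xor-assoc; xor-same) renaming (_≟_ to _≟ᵇ_)
open import Data.Empty using (⊥-elim)
open import Data.Fin using (Fin; zero; suc)
open import Data.Integer as ℤ using ()
import Data.Integer.Properties as ℤP
open import Data.List using (List; []; _∷_; map; _++_; length; filterᵇ)
import Data.List.Properties as Listₚ
open import Data.List.Membership.Propositional using () renaming (_∈_ to _∈ₗ_)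
open import Data.List.Membership.Propositional.Properties using (∈-map⁻)
open import Data.List.Relation.Unary.All as All using (All; []; _∷_)
import Data.List.Relation.Unary.AllPairs as AllPairs
open import Data.List.Relation.Unary.Unique.Propositional using (Unique)
import Data.List.Relation.Unary.Unique.Propositional.Properties as Uniqueₚ
open import Data.Nat as ℕ using (ℕ; zero; suc; _^_; _∸_; z≤n; s≤s)
open import Data.Nat.Coprimality using (1-coprimeTo) renaming (sym to coprime-sym)
import Data.Nat.Properties as ℕP
import Data.Nat.Tactic.RingSolver as ℕ-Solver
open import Data.Product using (Σ; _×_; _,_; proj₁; proj₂)
open import Data.Rational as ℚ using (ℚ; 0ℚ; 1ℚ; _+_; _*_; _-_; ∣_∣; _≤_; _<_; _/_; mkℚ; ↥_; ↧ₙ_; *≤*; *<*)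
import Data.Rational.Properties as ℚP
open import Data.Sum using (_⊎_; inj₁; inj₂)
open import Data.Unit using (⊤; tt)
open import Data.Vec as Vec using (Vec; []; _∷_; lookup; tabulate; replicate; take; drop)
import Data.Vec.Properties as Vecₚ
open import Data.Vec.Membership.Propositional using (_∈_)
open import Data.Vec.Membership.Propositional.Properties using (∈-++⁺ˡ)
open import Data.Vec.Relation.Unary.Any using (here; there; index)
open import Data.Vec.Relation.Unary.Any.Properties using (lookup-index)
import Data.Vec.Relation.Unary.All as VecAll
import Data.Vec.Relation.Unary.All.Properties as VecAllₚ
import Data.Vec.Relation.Unary.AllPairs as VecAllPairs
open import Data.Vec.Relation.Unary.Unique.Propositional using () renaming (Unique to VecUnique)
open import Data.Vec.Relation.Unary.Unique.Propositional.Properties using (lookup-injective)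
open import Function using (_∘_; id; case_of_)
open import Function.Definitions using (Injective)
open import Relation.Binary.PropositionalEquality
open import Relation.Nullary using (¬_; Dec; yes; no)
open import Relation.Nullary.Decidable using (⌊_⌋; dec⇒maybe)
open import Tactic.RingSolver using (solve-∀)
open import Tactic.RingSolver.Core.AlmostCommutativeRing using (AlmostCommutativeRing; fromCommutativeRing)
open import Algebra.Properties.CommutativeSemigroup (CommutativeMonoid.commutativeSemigroup ℚP.+-0-commutativeMonoid)
  using () renaming (interchange to +-interchange)
open import Defs

ℚ-ring : AlmostCommutativeRing 0ℓ 0ℓ
ℚ-ring = fromCommutativeRing ℚP.+-*-commutativeRing (λ x → dec⇒maybe (0ℚ ℚP.≟ x))

-- Definitionally the cast + n / 1 used in the statement.
fromℕ : ℕ → ℚ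
fromℕ n = ℤ.+ n / 1

fromℕ≡mkℚ : ∀ n → fromℕ n ≡ mkℚ (ℤ.+ n) 0 (coprime-sym (1-coprimeTo n))
fromℕ≡mkℚ n = ℚP.fromℚᵘ-toℚᵘ (mkℚ (ℤ.+ n) 0 (coprime-sym (1-coprimeTo n)))

fromℕ-+ : ∀ m n → fromℕ (m ℕ.+ n) ≡ fromℕ m + fromℕ n
fromℕ-+ m n = trans (cong₂ (λ a b → (a ℤ.+ b) / 1) (sym (ℤP.*-identityʳ (ℤ.+ m))) (sym (ℤP.*-identityʳ (ℤ.+ n))))
                    (sym (cong₂ _+_ (fromℕ≡mkℚ m) (fromℕ≡mkℚ n)))

fromℕ-* : ∀ m n → fromℕ (m ℕ.* n) ≡ fromℕ m * fromℕ n
fromℕ-* m n = trans (cong (_/ 1) (ℤP.pos-* m n)) (sym (cong₂ _*_ (fromℕ≡mkℚ m) (fromℕ≡mkℚ n)))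

fromℕ-mono-≤ : ∀ {m n} → m ℕ.≤ n → fromℕ m ≤ fromℕ n
fromℕ-mono-≤ {m} {n} m≤n = subst₂ _≤_ (sym (fromℕ≡mkℚ m)) (sym (fromℕ≡mkℚ n))
  (*≤* (ℤP.*-monoʳ-≤-nonNeg (ℤ.+ 1) (ℤ.+≤+ m≤n)))

fromℕ-mono-< : ∀ {m n} → m ℕ.< n → fromℕ m < fromℕ n
fromℕ-mono-< {m} {n} m<n = subst₂ _<_ (sym (fromℕ≡mkℚ m)) (sym (fromℕ≡mkℚ n))
  (*<* (subst₂ ℤ._<_ (sym (ℤP.*-identityʳ (ℤ.+ m))) (sym (ℤP.*-identityʳ (ℤ.+ n))) (ℤ.+<+ m<n)))

fromℕ-cancel-< : ∀ {m n} → fromℕ m < fromℕ n → m ℕ.< n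
fromℕ-cancel-< {m} {n} lt with subst₂ _<_ (fromℕ≡mkℚ m) (fromℕ≡mkℚ n) lt
... | *<* p = ℤP.drop‿+<+ (subst₂ ℤ._<_ (ℤP.*-identityʳ (ℤ.+ m)) (ℤP.*-identityʳ (ℤ.+ n)) p)

fromℕ-nonneg : ∀ n → 0ℚ ≤ fromℕ n
fromℕ-nonneg n = fromℕ-mono-≤ {0} {n} ℕ.z≤n

fromℕ-suc-* : ∀ n c → c + fromℕ n * c ≡ fromℕ (suc n) * c
fromℕ-suc-* n c = trans (identity c (fromℕ n)) (cong (_* c) (sym (fromℕ-+ 1 n)))
  where
  identity : ∀ c k → c + k * c ≡ (1ℚ + k) * c
  identity = solve-∀ ℚ-ring

≤-+-nonneg : ∀ {a b} → 0ℚ ≤ b → a ≤ a + b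
≤-+-nonneg {a} 0≤b = subst (_≤ a + _) (ℚP.+-identityʳ a) (ℚP.+-monoʳ-≤ a 0≤b)

*-monoˡ-≤ : ∀ {r p q} → 0ℚ ≤ r → p ≤ q → r * p ≤ r * q
*-monoˡ-≤ {r} 0≤r = ℚP.*-monoˡ-≤-nonNeg r {{ℚ.nonNegative 0≤r}}

*-monoʳ-≤ : ∀ {r p q} → 0ℚ ≤ r → p ≤ q → p * r ≤ q * r
*-monoʳ-≤ {r} 0≤r = ℚP.*-monoʳ-≤-nonNeg r {{ℚ.nonNegative 0≤r}}

*-mono-≤ : ∀ {a b c d} → 0ℚ ≤ a → a ≤ b → 0ℚ ≤ c → c ≤ d → a * c ≤ b * d
*-mono-≤ 0≤a a≤b 0≤c c≤d = ℚP.≤-trans (*-monoʳ-≤ 0≤c a≤b) (*-monoˡ-≤ (ℚP.≤-trans 0≤a a≤b) c≤d)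

*-nonneg : ∀ {a b} → 0ℚ ≤ a → 0ℚ ≤ b → 0ℚ ≤ a * b
*-nonneg {a} 0≤a 0≤b = subst (_≤ a * _) (ℚP.*-zeroʳ a) (*-monoˡ-≤ 0≤a 0≤b)

*-pos : ∀ {a b} → 0ℚ < a → 0ℚ < b → 0ℚ < a * b
*-pos {a} {b} 0<a 0<b = ℚP.positive⁻¹ (a * b) {{ℚP.pos*pos⇒pos a {{ℚ.positive 0<a}} b {{ℚ.positive 0<b}}}}

*-cancelʳ-≤ : ∀ {a b} c → 0ℚ < c → a * c ≤ b * c → a ≤ b
*-cancelʳ-≤ c 0<c = ℚP.*-cancelʳ-≤-pos c {{ℚ.positive 0<c}}

*-cancelˡ-≡ : ∀ c {a b} → 0ℚ < c → c * a ≡ c * b → a ≡ b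
*-cancelˡ-≡ c 0<c ca≡cb = ℚP.≤-antisym (cancel (ℚP.≤-reflexive ca≡cb)) (cancel (ℚP.≤-reflexive (sym ca≡cb)))
  where
  cancel : ∀ {x y} → c * x ≤ c * y → x ≤ y
  cancel = ℚP.*-cancelˡ-≤-pos c {{ℚ.positive 0<c}}

square-nonneg : ∀ x → 0ℚ ≤ x * x
square-nonneg x with ℚP.≤-total 0ℚ x
... | inj₁ 0≤x = *-nonneg 0≤x 0≤x
... | inj₂ x≤0 = ℚP.nonNegative⁻¹ (x * x)
  {{ℚP.nonPos*nonPos⇒nonPos x {{ℚ.nonPositive x≤0}} x {{ℚ.nonPositive x≤0}}}}

≤-from-squares : ∀ {a u} → 0ℚ ≤ u → a * a ≤ u * u → a ≤ u
≤-from-squares {a} {u} 0≤u a²≤u² with a ℚP.≤? u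
... | yes a≤u = a≤u
... | no a≰u = ⊥-elim (ℚP.<-irrefl refl (ℚP.<-≤-trans u²<a² a²≤u²))
  where
  u<a = ℚP.≰⇒> a≰u
  u²<a² : u * u < a * a
  u²<a² = ℚP.≤-<-trans (*-monoʳ-≤ 0≤u (ℚP.<⇒≤ u<a))
                       (ℚP.*-monoʳ-<-pos a {{ℚ.positive (ℚP.≤-<-trans 0≤u u<a)}} u<a)

-- Finite sums and moment inequalities

∑ : {A : Set} → List A → (A → ℚ) → ℚ
∑ L f = sumℚ (map f L)

syntax ∑ L (λ x → e) = ∑[ x ∈ L ] e

module _ {A : Set} where

  ∑-cong : ∀ (L : List A) {f g : A → ℚ} → (∀ x → f x ≡ g x) → ∑ L f ≡ ∑ L g
  ∑-cong []      f≗g = refl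
  ∑-cong (x ∷ L) f≗g = cong₂ _+_ (f≗g x) (∑-cong L f≗g)

  ∑-cong-All : ∀ (L : List A) {f g : A → ℚ} → All (λ x → f x ≡ g x) L → ∑ L f ≡ ∑ L g
  ∑-cong-All []      []           = refl
  ∑-cong-All (x ∷ L) (fx≡gx ∷ eq) = cong₂ _+_ fx≡gx (∑-cong-All L eq)

  ∑-++ : ∀ (L M : List A) f → ∑ (L ++ M) f ≡ ∑ L f + ∑ M f
  ∑-++ []      M f = sym (ℚP.+-identityˡ _)
  ∑-++ (x ∷ L) M f = trans (cong (f x +_) (∑-++ L M f)) (sym (ℚP.+-assoc (f x) _ _))

  ∑-zero : ∀ (L : List A) → ∑[ _ ∈ L ] 0ℚ ≡ 0ℚ
  ∑-zero []      = refl
  ∑-zero (x ∷ L) = cong (0ℚ +_) (∑-zero L)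

  ∑-+ : ∀ (L : List A) f g → ∑[ x ∈ L ] (f x + g x) ≡ ∑ L f + ∑ L g
  ∑-+ []      f g = refl
  ∑-+ (x ∷ L) f g = trans (cong (f x + g x +_) (∑-+ L f g)) (+-interchange (f x) (g x) (∑ L f) (∑ L g))

  ∑-*ˡ : ∀ (L : List A) c f → ∑[ x ∈ L ] (c * f x) ≡ c * ∑ L f
  ∑-*ˡ []      c f = sym (ℚP.*-zeroʳ c)
  ∑-*ˡ (x ∷ L) c f = trans (cong (c * f x +_) (∑-*ˡ L c f)) (sym (ℚP.*-distribˡ-+ c (f x) (∑ L f)))

  ∑-const : ∀ (L : List A) c → ∑[ _ ∈ L ] c ≡ fromℕ (length L) * c
  ∑-const []      c = sym (ℚP.*-zeroˡ c)
  ∑-const (x ∷ L) c = trans (cong (c +_) (∑-const L c)) (fromℕ-suc-* (length L) c)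

  ∑-count : ∀ (L : List A) (P : A → Bool) c →
            ∑[ x ∈ L ] (if P x then c else 0ℚ) ≡ fromℕ (length (filterᵇ P L)) * c
  ∑-count []      P c = sym (ℚP.*-zeroˡ c)
  ∑-count (x ∷ L) P c with P x
  ... | true  = trans (cong (c +_) (∑-count L P c)) (fromℕ-suc-* (length (filterᵇ P L)) c)
  ... | false = trans (ℚP.+-identityˡ _) (∑-count L P c)

  ∑-mono-≤ : ∀ (L : List A) {f g : A → ℚ} → (∀ x → f x ≤ g x) → ∑ L f ≤ ∑ L g
  ∑-mono-≤ []      f≤g = ℚP.≤-refl
  ∑-mono-≤ (x ∷ L) f≤g = ℚP.+-mono-≤ (f≤g x) (∑-mono-≤ L f≤g)

  ∑-nonneg : ∀ (L : List A) {f : A → ℚ} → (∀ x → 0ℚ ≤ f x) → 0ℚ ≤ ∑ L f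
  ∑-nonneg L {f} 0≤f = subst (_≤ ∑ L f) (∑-zero L) (∑-mono-≤ L 0≤f)

  ∑-*ʳ : ∀ (L : List A) f c → ∑ L f * c ≡ ∑[ x ∈ L ] (f x * c)
  ∑-*ʳ L f c = trans (ℚP.*-comm (∑ L f) c) (trans (sym (∑-*ˡ L c f)) (∑-cong L (λ x → ℚP.*-comm c (f x))))

  ∑-*-∑ : ∀ (L : List A) f g → ∑ L f * ∑ L g ≡ ∑[ a ∈ L ] ∑[ b ∈ L ] (f a * g b)
  ∑-*-∑ L f g = trans (∑-*ʳ L f (∑ L g)) (∑-cong L (λ a → sym (∑-*ˡ L (f a) g)))

  ∑-cube : ∀ (L : List A) u q →
           ∑ L u * ∑ L u * ∑ L u * q ≡ ∑[ a ∈ L ] ∑[ b ∈ L ] ∑[ c ∈ L ] (u a * u b * u c * q)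
  ∑-cube L u q = begin
    U * U * U * q
      ≡⟨ cong (λ z → z * U * q) (∑-*-∑ L u u) ⟩
    ∑[ a ∈ L ] ∑[ b ∈ L ] (u a * u b) * U * q
      ≡⟨ cong (_* q) (trans (∑-*ʳ L _ U) (∑-cong L (λ a → trans (∑-*ʳ L _ U) (∑-cong L (λ b → sym (∑-*ˡ L (u a * u b) u)))))) ⟩
    ∑[ a ∈ L ] ∑[ b ∈ L ] ∑[ c ∈ L ] (u a * u b * u c) * q
      ≡⟨ trans (∑-*ʳ L _ q) (∑-cong L (λ a → trans (∑-*ʳ L _ q) (∑-cong L (λ b → ∑-*ʳ L _ q)))) ⟩
    ∑[ a ∈ L ] ∑[ b ∈ L ] ∑[ c ∈ L ] (u a * u b * u c * q) ∎
    where
    open ≡-Reasoning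
    U = ∑ L u

module _ {A B : Set} where

  ∑-map : ∀ (L : List A) (g : A → B) f → ∑ (map g L) f ≡ ∑[ x ∈ L ] f (g x)
  ∑-map []      g f = refl
  ∑-map (x ∷ L) g f = cong (f (g x) +_) (∑-map L g f)

  ∑-comm : ∀ (L : List A) (M : List B) (f : A → B → ℚ) →
           ∑[ a ∈ L ] ∑[ b ∈ M ] f a b ≡ ∑[ b ∈ M ] ∑[ a ∈ L ] f a b
  ∑-comm []      M f = sym (∑-zero M)
  ∑-comm (a ∷ L) M f = trans (cong (∑ M (f a) +_) (∑-comm L M f))
                             (sym (∑-+ M (f a) (λ b → ∑[ a ∈ L ] f a b)))

four-mul-≤-square-sum : ∀ a b → fromℕ 4 * (a * b) ≤ (a + b) * (a + b)
four-mul-≤-square-sum a b = subst₂ _≤_ (ℚP.+-identityʳ _) (identity a b)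
  (ℚP.+-monoʳ-≤ (fromℕ 4 * (a * b)) (square-nonneg (a - b)))
  where
  identity : ∀ a b → fromℕ 4 * (a * b) + (a - b) * (a - b) ≡ (a + b) * (a + b)
  identity = solve-∀ ℚ-ring

cauchy-schwarz-step : ∀ {x y X Y} z Z → 0ℚ ≤ x → 0ℚ ≤ y → 0ℚ ≤ X → 0ℚ ≤ Y →
                      z * z ≤ x * y → Z * Z ≤ X * Y → (z + Z) * (z + Z) ≤ (x + X) * (y + Y)
cauchy-schwarz-step {x} {y} {X} {Y} z Z 0≤x 0≤y 0≤X 0≤Y z²≤xy Z²≤XY =
  subst₂ _≤_ (expand-left z Z) (expand-right x y X Y)
    (ℚP.+-mono-≤ (ℚP.+-mono-≤ z²≤xy cross) Z²≤XY)
  where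
  open ℚP.≤-Reasoning
  cross-squared : (fromℕ 2 * z * Z) * (fromℕ 2 * z * Z) ≤ (x * Y + X * y) * (x * Y + X * y)
  cross-squared = begin
    (fromℕ 2 * z * Z) * (fromℕ 2 * z * Z)  ≡⟨ rearrange z Z ⟩
    fromℕ 4 * ((z * z) * (Z * Z))          ≤⟨ *-monoˡ-≤ (fromℕ-nonneg 4)
                                                (*-mono-≤ (square-nonneg z) z²≤xy (square-nonneg Z) Z²≤XY) ⟩
    fromℕ 4 * ((x * y) * (X * Y))          ≡⟨ cong (fromℕ 4 *_) (regroup x y X Y) ⟩
    fromℕ 4 * ((x * Y) * (X * y))          ≤⟨ four-mul-≤-square-sum (x * Y) (X * y) ⟩
    (x * Y + X * y) * (x * Y + X * y)      ∎
    where
    rearrange : ∀ z Z → (fromℕ 2 * z * Z) * (fromℕ 2 * z * Z) ≡ fromℕ 4 * ((z * z) * (Z * Z))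
    rearrange = solve-∀ ℚ-ring
    regroup : ∀ x y X Y → (x * y) * (X * Y) ≡ (x * Y) * (X * y)
    regroup = solve-∀ ℚ-ring
  cross : fromℕ 2 * z * Z ≤ x * Y + X * y
  cross = ≤-from-squares (ℚP.+-mono-≤ (*-nonneg 0≤x 0≤Y) (*-nonneg 0≤X 0≤y)) cross-squared
  expand-left : ∀ z Z → z * z + fromℕ 2 * z * Z + Z * Z ≡ (z + Z) * (z + Z)
  expand-left = solve-∀ ℚ-ring
  expand-right : ∀ x y X Y → x * y + (x * Y + X * y) + X * Y ≡ (x + X) * (y + Y)
  expand-right = solve-∀ ℚ-ring

module _ {A : Set} where

  cauchy-schwarz : ∀ (L : List A) (P Q R : A → ℚ) → (∀ a → 0ℚ ≤ P a) → (∀ a → 0ℚ ≤ Q a) →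
                   (∀ a → R a * R a ≤ P a * Q a) → ∑ L R * ∑ L R ≤ ∑ L P * ∑ L Q
  cauchy-schwarz []      P Q R 0≤P 0≤Q R²≤PQ = ℚP.≤-refl
  cauchy-schwarz (a ∷ L) P Q R 0≤P 0≤Q R²≤PQ =
    cauchy-schwarz-step (R a) (∑ L R) (0≤P a) (0≤Q a) (∑-nonneg L 0≤P) (∑-nonneg L 0≤Q) (R²≤PQ a)
      (cauchy-schwarz L P Q R 0≤P 0≤Q R²≤PQ)

  -- √κ · w ≤ √μ · e pointwise implies the same for the sums; squared to avoid roots.
  ∑-≤-from-squares : ∀ (L : List A) (κ μ : ℚ) (w e : A → ℚ) → 0ℚ < κ → 0ℚ ≤ μ → (∀ a → 0ℚ ≤ e a) →
                     (∀ a → κ * (w a * w a) ≤ μ * (e a * e a)) → κ * (∑ L w * ∑ L w) ≤ μ * (∑ L e * ∑ L e)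
  ∑-≤-from-squares L κ μ w e 0<κ 0≤μ 0≤e κw²≤μe² = *-cancelʳ-≤ κ 0<κ (begin
    κ * (∑ L w * ∑ L w) * κ                               ≡⟨ regroup₁ κ (∑ L w) ⟩
    (κ * ∑ L w) * (κ * ∑ L w)                             ≡⟨ cong (λ z → z * z) (∑-*ˡ L κ w) ⟨
    ∑[ a ∈ L ] (κ * w a) * ∑[ a ∈ L ] (κ * w a)           ≤⟨ cauchy-schwarz L (λ a → κ * e a) (λ a → μ * e a) (λ a → κ * w a)
                                                                (λ a → *-nonneg 0≤κ (0≤e a)) (λ a → *-nonneg 0≤μ (0≤e a)) pointwise ⟩
    ∑[ a ∈ L ] (κ * e a) * ∑[ a ∈ L ] (μ * e a)          ≡⟨ cong₂ _*_ (∑-*ˡ L κ e) (∑-*ˡ L μ e) ⟩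
    (κ * ∑ L e) * (μ * ∑ L e)                            ≡⟨ regroup₂ κ μ (∑ L e) ⟩
    μ * (∑ L e * ∑ L e) * κ                              ∎)
    where
    open ℚP.≤-Reasoning
    0≤κ = ℚP.<⇒≤ 0<κ
    regroup₁ : ∀ κ s → κ * (s * s) * κ ≡ (κ * s) * (κ * s)
    regroup₁ = solve-∀ ℚ-ring
    regroup₂ : ∀ κ μ s → (κ * s) * (μ * s) ≡ μ * (s * s) * κ
    regroup₂ = solve-∀ ℚ-ring
    regroup₃ : ∀ κ w → κ * (κ * (w * w)) ≡ (κ * w) * (κ * w)
    regroup₃ = solve-∀ ℚ-ring
    regroup₄ : ∀ κ μ e → κ * (μ * (e * e)) ≡ (κ * e) * (μ * e)
    regroup₄ = solve-∀ ℚ-ring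
    pointwise : ∀ a → (κ * w a) * (κ * w a) ≤ (κ * e a) * (μ * e a)
    pointwise a = subst₂ _≤_ (regroup₃ κ (w a)) (regroup₄ κ μ (e a)) (*-monoˡ-≤ 0≤κ (κw²≤μe² a))

  lyapunov : ∀ (L : List A) (a : A → ℚ) → (∀ x → 0ℚ ≤ a x) →
             let M₁ = ∑ L a
                 M₂ = ∑[ x ∈ L ] (a x * a x)
                 M₄ = ∑[ x ∈ L ] ((a x * a x) * (a x * a x))
             in (M₂ * M₂) * (M₂ * M₂) ≤ (M₁ * M₁) * (M₂ * M₄)
  lyapunov L a 0≤a = begin
    (M₂ * M₂) * (M₂ * M₂)   ≤⟨ *-mono-≤ (square-nonneg M₂) cs₁ (square-nonneg M₂) cs₁ ⟩
    (M₁ * M₃) * (M₁ * M₃)   ≡⟨ regroup M₁ M₃ ⟩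
    (M₁ * M₁) * (M₃ * M₃)   ≤⟨ *-monoˡ-≤ (square-nonneg M₁) cs₂ ⟩
    (M₁ * M₁) * (M₂ * M₄)   ∎
    where
    open ℚP.≤-Reasoning
    a² a³ a⁴ : A → ℚ
    a² x = a x * a x
    a³ x = a x * a x * a x
    a⁴ x = a² x * a² x
    M₁ = ∑ L a
    M₂ = ∑ L a²
    M₃ = ∑ L a³
    M₄ = ∑ L a⁴
    regroup : ∀ p q → (p * q) * (p * q) ≡ (p * p) * (q * q)
    regroup = solve-∀ ℚ-ring
    a²a²≡a·a³ : ∀ y → (y * y) * (y * y) ≡ y * (y * y * y)
    a²a²≡a·a³ = solve-∀ ℚ-ring
    a³a³≡a²a⁴ : ∀ y → (y * y * y) * (y * y * y) ≡ (y * y) * ((y * y) * (y * y))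
    a³a³≡a²a⁴ = solve-∀ ℚ-ring
    cs₁ : M₂ * M₂ ≤ M₁ * M₃
    cs₁ = cauchy-schwarz L a a³ a² 0≤a (λ x → *-nonneg (square-nonneg (a x)) (0≤a x))
            (λ x → ℚP.≤-reflexive (a²a²≡a·a³ (a x)))
    cs₂ : M₃ * M₃ ≤ M₂ * M₄
    cs₂ = cauchy-schwarz L a² a⁴ a³ (λ x → square-nonneg (a x)) (λ x → square-nonneg (a² x))
            (λ x → ℚP.≤-reflexive (a³a³≡a²a⁴ (a x)))

  -- With sums over N points normalised, this is (E|Y|)² ≥ (E Y²)³ / E Y⁴.
  first-moment-bound : ∀ (L : List A) (Y : A → ℚ) (N Z κ : ℚ) → 0ℚ < N → 0ℚ ≤ κ →
    ∑[ x ∈ L ] (Y x * Y x) ≡ N * Z →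
    ∑[ x ∈ L ] ((Y x * Y x) * (Y x * Y x)) ≤ κ * N * (Z * Z) →
    N * N * Z ≤ κ * (∑[ x ∈ L ] ∣ Y x ∣ * ∑[ x ∈ L ] ∣ Y x ∣)
  first-moment-bound L Y N Z κ 0<N 0≤κ M₂≡NZ M₄≤κNZ² with Z ℚP.≤? 0ℚ
  ... | yes Z≤0 = ℚP.≤-trans (ℚP.≤-trans (*-monoˡ-≤ (*-nonneg 0≤N 0≤N) Z≤0) (ℚP.≤-reflexive (ℚP.*-zeroʳ (N * N))))
                             (*-nonneg 0≤κ (square-nonneg M₁))
    where
    0≤N = ℚP.<⇒≤ 0<N
    M₁ = ∑[ x ∈ L ] ∣ Y x ∣
  ... | no Z≰0 = *-cancelʳ-≤ W 0<W (begin
    N * N * Z * W                          ≡⟨ regroup₁ N Z ⟩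
    (N * Z * (N * Z)) * (N * Z * (N * Z))  ≡⟨ cong (λ z → (z * z) * (z * z)) (sym M₂≡NZ′) ⟩
    (M₂ * M₂) * (M₂ * M₂)                  ≤⟨ lyapunov L ∣Y∣ (λ x → ℚP.0≤∣p∣ (Y x)) ⟩
    (M₁ * M₁) * (M₂ * M₄)                  ≤⟨ *-monoˡ-≤ (square-nonneg M₁)
                                                (*-mono-≤ 0≤M₂ ℚP.≤-refl 0≤M₄ M₄≤κNZ²′) ⟩
    (M₁ * M₁) * (M₂ * (κ * N * (Z * Z)))   ≡⟨ cong (λ z → (M₁ * M₁) * (z * (κ * N * (Z * Z)))) M₂≡NZ′ ⟩
    (M₁ * M₁) * (N * Z * (κ * N * (Z * Z))) ≡⟨ regroup₂ M₁ N Z κ ⟩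
    κ * (M₁ * M₁) * W                      ∎)
    where
    open ℚP.≤-Reasoning
    ∣Y∣ : A → ℚ
    ∣Y∣ x = ∣ Y x ∣
    abs-square : ∀ y → ∣ y ∣ * ∣ y ∣ ≡ y * y
    abs-square y = trans (sym (ℚP.∣p*q∣≡∣p∣*∣q∣ y y)) (ℚP.0≤p⇒∣p∣≡p (square-nonneg y))
    M₁ = ∑ L ∣Y∣
    M₂ = ∑[ x ∈ L ] (∣Y∣ x * ∣Y∣ x)
    M₄ = ∑[ x ∈ L ] ((∣Y∣ x * ∣Y∣ x) * (∣Y∣ x * ∣Y∣ x))
    M₂≡NZ′ : M₂ ≡ N * Z
    M₂≡NZ′ = trans (∑-cong L (λ x → abs-square (Y x))) M₂≡NZ
    M₄≤κNZ²′ : M₄ ≤ κ * N * (Z * Z)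
    M₄≤κNZ²′ = subst (_≤ κ * N * (Z * Z)) (∑-cong L (λ x → sym (cong₂ _*_ (abs-square (Y x)) (abs-square (Y x))))) M₄≤κNZ²
    0≤M₂ : 0ℚ ≤ M₂
    0≤M₂ = ∑-nonneg L (λ x → square-nonneg (∣Y∣ x))
    0≤M₄ : 0ℚ ≤ M₄
    0≤M₄ = ∑-nonneg L (λ x → square-nonneg (∣Y∣ x * ∣Y∣ x))
    0<Z = ℚP.≰⇒> Z≰0
    W = N * Z * Z * (N * Z)
    0<W : 0ℚ < W
    0<W = *-pos (*-pos (*-pos 0<N 0<Z) 0<Z) (*-pos 0<N 0<Z)
    regroup₁ : ∀ N Z → N * N * Z * (N * Z * Z * (N * Z)) ≡ (N * Z * (N * Z)) * (N * Z * (N * Z))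
    regroup₁ = solve-∀ ℚ-ring
    regroup₂ : ∀ M N Z κ → (M * M) * (N * Z * (κ * N * (Z * Z))) ≡ κ * (M * M) * (N * Z * Z * (N * Z))
    regroup₂ = solve-∀ ℚ-ring

  average-of-tail : ∀ (L : List A) (f : A → ℚ) a c → f a < c →
                    fromℕ (length (a ∷ L)) * c ≤ ∑ (a ∷ L) f → fromℕ (length L) * c ≤ ∑ L f
  average-of-tail L f a c fa<c h with fromℕ (length L) * c ℚP.≤? ∑ L f
  ... | yes h′ = h′
  ... | no h′̸  = ⊥-elim (ℚP.<-irrefl refl (ℚP.<-≤-trans sum<bound h))
    where
    sum<bound : f a + ∑ L f < fromℕ (length (a ∷ L)) * c
    sum<bound = subst (f a + ∑ L f <_) (fromℕ-suc-* (length L) c) (ℚP.+-mono-< fa<c (ℚP.≰⇒> h′̸))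

  average-attained : ∀ (L : List A) (f : A → ℚ) c → 0 ℕ.< length L →
                     fromℕ (length L) * c ≤ ∑ L f → Σ A (λ a → c ≤ f a)
  average-attained (a ∷ L) f c _ h with c ℚP.≤? f a | L
  ... | yes c≤fa | _      = a , c≤fa
  ... | no c≰fa  | []     = ⊥-elim (c≰fa (subst₂ _≤_ (ℚP.*-identityˡ c) (ℚP.+-identityʳ (f a)) h))
  ... | no c≰fa  | b ∷ L′ =
    average-attained (b ∷ L′) f c (ℕ.s≤s ℕ.z≤n) (average-of-tail (b ∷ L′) f a c (ℚP.≰⇒> c≰fa) h)

-- Bit strings and k-wise uniformity

length-allBitStr : ∀ n → length (allBitStr n) ≡ 2 ^ n
length-allBitStr zero    = refl
length-allBitStr (suc n) = begin
  length (map (false ∷_) (allBitStr n) ++ map (true ∷_) (allBitStr n))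
    ≡⟨ Listₚ.length-++ (map (false ∷_) (allBitStr n)) ⟩
  length (map (false ∷_) (allBitStr n)) ℕ.+ length (map (true ∷_) (allBitStr n))
    ≡⟨ cong₂ ℕ._+_ (Listₚ.length-map _ (allBitStr n)) (Listₚ.length-map _ (allBitStr n)) ⟩
  length (allBitStr n) ℕ.+ length (allBitStr n)
    ≡⟨ cong (λ z → z ℕ.+ z) (length-allBitStr n) ⟩
  2 ^ n ℕ.+ 2 ^ n
    ≡⟨ cong (2 ^ n ℕ.+_) (ℕP.+-identityʳ (2 ^ n)) ⟨
  2 ^ suc n ∎
  where open ≡-Reasoning

allBitStr-unique : ∀ n → Unique (allBitStr n)
allBitStr-unique zero    = All.[] AllPairs.∷ AllPairs.[]
allBitStr-unique (suc n) = Uniqueₚ.++⁺ (Uniqueₚ.map⁺ Vecₚ.∷-injectiveʳ (allBitStr-unique n))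
                                       (Uniqueₚ.map⁺ Vecₚ.∷-injectiveʳ (allBitStr-unique n))
                                       heads-differ
  where
  heads-differ : ∀ {v} → ¬ (v ∈ₗ map (false ∷_) (allBitStr n) × v ∈ₗ map (true ∷_) (allBitStr n))
  heads-differ (v∈F , v∈T) with ∈-map⁻ (false ∷_) v∈F | ∈-map⁻ (true ∷_) v∈T
  ... | _ , _ , refl | _ , _ , ()

∑-allBitStr-suc : ∀ n (F : BitStr (suc n) → ℚ) →
                  ∑ (allBitStr (suc n)) F ≡ ∑[ v ∈ allBitStr n ] F (false ∷ v) + ∑[ v ∈ allBitStr n ] F (true ∷ v)
∑-allBitStr-suc n F = trans (∑-++ (map (false ∷_) (allBitStr n)) _ F)
  (cong₂ _+_ (∑-map (allBitStr n) (false ∷_) F) (∑-map (allBitStr n) (true ∷_) F))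

∑-allBitStr-++ : ∀ k l (F : BitStr (k ℕ.+ l) → ℚ) →
                 ∑ (allBitStr (k ℕ.+ l)) F ≡ ∑[ β ∈ allBitStr k ] ∑[ y ∈ allBitStr l ] F (β Vec.++ y)
∑-allBitStr-++ zero    l F = sym (ℚP.+-identityʳ _)
∑-allBitStr-++ (suc k) l F = begin
  ∑ (allBitStr (suc k ℕ.+ l)) F
    ≡⟨ ∑-allBitStr-suc (k ℕ.+ l) F ⟩
  ∑[ v ∈ allBitStr (k ℕ.+ l) ] F (false ∷ v) + ∑[ v ∈ allBitStr (k ℕ.+ l) ] F (true ∷ v)
    ≡⟨ cong₂ _+_ (∑-allBitStr-++ k l (F ∘ (false ∷_))) (∑-allBitStr-++ k l (F ∘ (true ∷_))) ⟩
  ∑[ β ∈ allBitStr k ] ∑[ y ∈ allBitStr l ] F (false ∷ β Vec.++ y)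
    + ∑[ β ∈ allBitStr k ] ∑[ y ∈ allBitStr l ] F (true ∷ β Vec.++ y)
    ≡⟨ ∑-allBitStr-suc k (λ β → ∑[ y ∈ allBitStr l ] F (β Vec.++ y)) ⟨
  ∑[ β ∈ allBitStr (suc k) ] ∑[ y ∈ allBitStr l ] F (β Vec.++ y) ∎
  where open ≡-Reasoning

agreesOn-∷ : ∀ {k} (z : Fin (suc k) → Bool) b (v : Vec Bool k) →
             agreesOn z id (lookup (b ∷ v)) ≡ ⌊ z zero ≟ᵇ b ⌋ ∧ agreesOn (z ∘ suc) id (lookup v)
agreesOn-∷ {k} z b v = cong (λ bs → ⌊ z zero ≟ᵇ b ⌋ ∧ and bs)
  (trans (Listₚ.map-tabulate suc test) (sym (Listₚ.map-tabulate id (test ∘ suc))))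
  where
  test : Fin (suc k) → Bool
  test i = ⌊ z i ≟ᵇ lookup (b ∷ v) i ⌋

∑-if-∧ : ∀ {A : Set} (L : List A) (c : Bool) (P : A → Bool) (F : A → ℚ) →
         ∑[ v ∈ L ] (if c ∧ P v then F v else 0ℚ) ≡ (if c then ∑[ v ∈ L ] (if P v then F v else 0ℚ) else 0ℚ)
∑-if-∧ L true  P F = refl
∑-if-∧ L false P F = ∑-zero L

select-bit : ∀ c (H : Bool → ℚ) →
             (if ⌊ c ≟ᵇ false ⌋ then H false else 0ℚ) + (if ⌊ c ≟ᵇ true ⌋ then H true else 0ℚ) ≡ H c
select-bit false H = ℚP.+-identityʳ (H false)
select-bit true  H = ℚP.+-identityˡ (H true)

∑-agreesOn : ∀ k (z : Fin k → Bool) (F : BitStr k → ℚ) →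
             ∑[ v ∈ allBitStr k ] (if agreesOn z id (lookup v) then F v else 0ℚ) ≡ F (tabulate z)
∑-agreesOn zero    z F = ℚP.+-identityʳ (F [])
∑-agreesOn (suc k) z F = begin
  ∑[ v ∈ allBitStr (suc k) ] (if agreesOn z id (lookup v) then F v else 0ℚ)
    ≡⟨ ∑-allBitStr-suc k _ ⟩
  term false + term true
    ≡⟨ cong₂ _+_ (restrict false) (restrict true) ⟩
  (if ⌊ z zero ≟ᵇ false ⌋ then F (false ∷ tabulate (z ∘ suc)) else 0ℚ)
    + (if ⌊ z zero ≟ᵇ true ⌋ then F (true ∷ tabulate (z ∘ suc)) else 0ℚ)
    ≡⟨ select-bit (z zero) (λ b → F (b ∷ tabulate (z ∘ suc))) ⟩
  F (tabulate z) ∎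
  where
  open ≡-Reasoning
  term : Bool → ℚ
  term b = ∑[ v ∈ allBitStr k ] (if agreesOn z id (lookup (b ∷ v)) then F (b ∷ v) else 0ℚ)
  restrict : ∀ b → term b ≡ (if ⌊ z zero ≟ᵇ b ⌋ then F (b ∷ tabulate (z ∘ suc)) else 0ℚ)
  restrict b = begin
    term b
      ≡⟨ ∑-cong (allBitStr k) (λ v → cong (λ c → if c then F (b ∷ v) else 0ℚ) (agreesOn-∷ z b v)) ⟩
    ∑[ v ∈ allBitStr k ] (if ⌊ z zero ≟ᵇ b ⌋ ∧ agreesOn (z ∘ suc) id (lookup v) then F (b ∷ v) else 0ℚ)
      ≡⟨ ∑-if-∧ (allBitStr k) ⌊ z zero ≟ᵇ b ⌋ _ _ ⟩
    (if ⌊ z zero ≟ᵇ b ⌋ then ∑[ v ∈ allBitStr k ] (if agreesOn (z ∘ suc) id (lookup v) then F (b ∷ v) else 0ℚ) else 0ℚ)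
      ≡⟨ cong (λ q → if ⌊ z zero ≟ᵇ b ⌋ then q else 0ℚ) (∑-agreesOn k (z ∘ suc) (F ∘ (b ∷_))) ⟩
    (if ⌊ z zero ≟ᵇ b ⌋ then F (b ∷ tabulate (z ∘ suc)) else 0ℚ) ∎

module _ {k m : ℕ} {I : Set} (G : BitStr m → I → Bool) (uniform : KWiseUniformGen k m G)
         (T : Fin k → I) (T-injective : Injective _≡_ _≡_ T) where

  seed-average : ∀ (Φ : BitStr k → ℚ) →
    fromℕ (2 ^ k) * ∑[ s ∈ allBitStr m ] Φ (tabulate (G s ∘ T)) ≡ fromℕ (2 ^ m) * ∑ (allBitStr k) Φ
  seed-average Φ = begin
    fromℕ (2 ^ k) * ∑[ s ∈ allBitStr m ] Φ (tabulate (G s ∘ T))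
      ≡⟨ cong (fromℕ (2 ^ k) *_) (∑-cong (allBitStr m) (λ s → sym (∑-agreesOn k (G s ∘ T) Φ))) ⟩
    fromℕ (2 ^ k) * ∑[ s ∈ allBitStr m ] ∑[ v ∈ allBitStr k ] indicator s v
      ≡⟨ cong (fromℕ (2 ^ k) *_) (∑-comm (allBitStr m) (allBitStr k) indicator) ⟩
    fromℕ (2 ^ k) * ∑[ v ∈ allBitStr k ] ∑[ s ∈ allBitStr m ] indicator s v
      ≡⟨ cong (fromℕ (2 ^ k) *_) (∑-cong (allBitStr k) (λ v → ∑-count (allBitStr m) (λ s → agreesOn (G s) T (lookup v)) (Φ v))) ⟩
    fromℕ (2 ^ k) * ∑[ v ∈ allBitStr k ] (fromℕ (count v) * Φ v)
      ≡⟨ ∑-*ˡ (allBitStr k) (fromℕ (2 ^ k)) _ ⟨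
    ∑[ v ∈ allBitStr k ] (fromℕ (2 ^ k) * (fromℕ (count v) * Φ v))
      ≡⟨ ∑-cong (allBitStr k) uniform-count ⟩
    ∑[ v ∈ allBitStr k ] (fromℕ (2 ^ m) * Φ v)
      ≡⟨ ∑-*ˡ (allBitStr k) (fromℕ (2 ^ m)) Φ ⟩
    fromℕ (2 ^ m) * ∑ (allBitStr k) Φ ∎
    where
    open ≡-Reasoning
    indicator : BitStr m → BitStr k → ℚ
    indicator s v = if agreesOn (G s) T (lookup v) then Φ v else 0ℚ
    count : BitStr k → ℕ
    count v = length (filterᵇ (λ s → agreesOn (G s) T (lookup v)) (allBitStr m))
    uniform-count : ∀ v → fromℕ (2 ^ k) * (fromℕ (count v) * Φ v) ≡ fromℕ (2 ^ m) * Φ v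
    uniform-count v = begin
      fromℕ (2 ^ k) * (fromℕ (count v) * Φ v)  ≡⟨ ℚP.*-assoc (fromℕ (2 ^ k)) (fromℕ (count v)) (Φ v) ⟨
      fromℕ (2 ^ k) * fromℕ (count v) * Φ v    ≡⟨ cong (_* Φ v) (ℚP.*-comm (fromℕ (2 ^ k)) (fromℕ (count v))) ⟩
      fromℕ (count v) * fromℕ (2 ^ k) * Φ v    ≡⟨ cong (_* Φ v) (fromℕ-* (count v) (2 ^ k)) ⟨
      fromℕ (count v ℕ.* 2 ^ k) * Φ v          ≡⟨ cong (λ c → fromℕ c * Φ v) (uniform T T-injective (lookup v)) ⟩
      fromℕ (2 ^ m) * Φ v                      ∎

  seed-sum-vanishes : ∀ (Φ : BitStr k → ℚ) → ∑ (allBitStr k) Φ ≡ 0ℚ →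
                      ∑[ s ∈ allBitStr m ] Φ (tabulate (G s ∘ T)) ≡ 0ℚ
  seed-sum-vanishes Φ ∑Φ≡0 = *-cancelˡ-≡ (fromℕ (2 ^ k)) (fromℕ-mono-< {0} (ℕP.m^n>0 2 k)) (begin
    fromℕ (2 ^ k) * ∑[ s ∈ allBitStr m ] Φ (tabulate (G s ∘ T))  ≡⟨ seed-average Φ ⟩
    fromℕ (2 ^ m) * ∑ (allBitStr k) Φ                             ≡⟨ cong (fromℕ (2 ^ m) *_) ∑Φ≡0 ⟩
    fromℕ (2 ^ m) * 0ℚ                                            ≡⟨ ℚP.*-zeroʳ (fromℕ (2 ^ m)) ⟩
    0ℚ                                                            ≡⟨ ℚP.*-zeroʳ (fromℕ (2 ^ k)) ⟨
    fromℕ (2 ^ k) * 0ℚ                                            ∎)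
    where open ≡-Reasoning

sign : Bool → ℚ
sign true  = 1ℚ
sign false = ℚ.- 1ℚ

sign-square : ∀ b → sign b * sign b ≡ 1ℚ
sign-square true  = refl
sign-square false = refl

sign-cancel : ∀ c → sign ⌊ false ≟ᵇ c ⌋ + sign ⌊ true ≟ᵇ c ⌋ ≡ 0ℚ
sign-cancel true  = refl
sign-cancel false = refl

module _ {j m : ℕ} {I : Set} (G : BitStr m → I → Bool) (uniform : KWiseUniformGen (suc j) m G)
         (T : Fin (suc j) → I) (T-injective : Injective _≡_ _≡_ T) where

  -- Flipping the bit at T zero negates the integrand, so its sum over all patterns is 0.
  parity-vanishes : ∀ (Ψ : BitStr j → ℚ) (c : Bool) →
    ∑[ s ∈ allBitStr m ] (Ψ (tabulate (G s ∘ T ∘ suc)) * sign ⌊ G s (T zero) ≟ᵇ c ⌋) ≡ 0ℚ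
  parity-vanishes Ψ c = seed-sum-vanishes G uniform T T-injective Φ (begin
    ∑ (allBitStr (suc j)) Φ
      ≡⟨ ∑-allBitStr-suc j Φ ⟩
    ∑[ v ∈ allBitStr j ] (Ψ v * sign ⌊ false ≟ᵇ c ⌋) + ∑[ v ∈ allBitStr j ] (Ψ v * sign ⌊ true ≟ᵇ c ⌋)
      ≡⟨ ∑-+ (allBitStr j) _ _ ⟨
    ∑[ v ∈ allBitStr j ] (Ψ v * sign ⌊ false ≟ᵇ c ⌋ + Ψ v * sign ⌊ true ≟ᵇ c ⌋)
      ≡⟨ ∑-cong (allBitStr j) (λ v → trans (sym (ℚP.*-distribˡ-+ (Ψ v) _ _))
                                           (trans (cong (Ψ v *_) (sign-cancel c)) (ℚP.*-zeroʳ (Ψ v)))) ⟩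
    ∑[ v ∈ allBitStr j ] 0ℚ
      ≡⟨ ∑-zero (allBitStr j) ⟩
    0ℚ ∎)
    where
    open ≡-Reasoning
    Φ : BitStr (suc j) → ℚ
    Φ (b ∷ v) = Ψ v * sign ⌊ b ≟ᵇ c ⌋

-- Moments of block correlations

square-expansion : ∀ a c y → c * c ≡ 1ℚ →
                   (a * c + y) * (a * c + y) ≡ a * a + fromℕ 2 * a * (y * c) + y * y
square-expansion a c y c²≡1 = begin
  (a * c + y) * (a * c + y)                          ≡⟨ expansion a c y ⟩
  a * a * (c * c) + fromℕ 2 * a * (y * c) + y * y    ≡⟨ cong (λ w → a * a * w + fromℕ 2 * a * (y * c) + y * y) c²≡1 ⟩
  a * a * 1ℚ + fromℕ 2 * a * (y * c) + y * y         ≡⟨ cong (λ w → w + fromℕ 2 * a * (y * c) + y * y) (ℚP.*-identityʳ (a * a)) ⟩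
  a * a + fromℕ 2 * a * (y * c) + y * y              ∎
  where
  open ≡-Reasoning
  expansion : ∀ a c y → (a * c + y) * (a * c + y) ≡ a * a * (c * c) + fromℕ 2 * a * (y * c) + y * y
  expansion = solve-∀ ℚ-ring

fourth-power-expansion : ∀ a c y → c * c ≡ 1ℚ →
  (a * c + y) * (a * c + y) * ((a * c + y) * (a * c + y))
    ≡ a * a * (a * a) + fromℕ 4 * (a * a * a) * (y * c) + fromℕ 6 * (a * a) * (y * y)
      + fromℕ 4 * a * (y * y * y * c) + (y * y) * (y * y)
fourth-power-expansion a c y c²≡1 = trans (expansion a c y) (trans (cong in-c² c²≡1) (at-one a c y))
  where
  in-c² : ℚ → ℚ
  in-c² w = a * a * (a * a) * (w * w) + fromℕ 4 * (a * a * a) * w * (y * c) + fromℕ 6 * (a * a) * w * (y * y)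
            + fromℕ 4 * a * (y * y * y * c) + (y * y) * (y * y)
  expansion : ∀ a c y →
    (a * c + y) * (a * c + y) * ((a * c + y) * (a * c + y))
      ≡ a * a * (a * a) * ((c * c) * (c * c)) + fromℕ 4 * (a * a * a) * (c * c) * (y * c)
        + fromℕ 6 * (a * a) * (c * c) * (y * y) + fromℕ 4 * a * (y * y * y * c) + (y * y) * (y * y)
  expansion = solve-∀ ℚ-ring
  at-one : ∀ a c y →
    a * a * (a * a) * (1ℚ * 1ℚ) + fromℕ 4 * (a * a * a) * 1ℚ * (y * c) + fromℕ 6 * (a * a) * 1ℚ * (y * y)
      + fromℕ 4 * a * (y * y * y * c) + (y * y) * (y * y)
    ≡ a * a * (a * a) + fromℕ 4 * (a * a * a) * (y * c) + fromℕ 6 * (a * a) * (y * y)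
      + fromℕ 4 * a * (y * y * y * c) + (y * y) * (y * y)
  at-one = solve-∀ ℚ-ring

avoid-three : ∀ {n} → 3 ℕ.≤ n → (u v w : BitStr n) → Σ (BitStr n) λ d → d ≢ u × d ≢ v × d ≢ w
avoid-three (s≤s (s≤s (s≤s _))) (u₀ ∷ u) (v₀ ∷ v₁ ∷ v) (w₀ ∷ w₁ ∷ w₂ ∷ w) =
  not u₀ ∷ not v₁ ∷ not w₂ ∷ replicate _ false ,
  (λ eq → not-¬ refl (sym (Vecₚ.∷-injectiveˡ eq))) ,
  (λ eq → not-¬ refl (sym (Vecₚ.∷-injectiveˡ (Vecₚ.∷-injectiveʳ eq)))) ,
  (λ eq → not-¬ refl (sym (Vecₚ.∷-injectiveˡ (Vecₚ.∷-injectiveʳ (Vecₚ.∷-injectiveʳ eq)))))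

module FourWise {n m : ℕ} (f : BitStr n → Bool) (G : BitStr m → BitStr n → Bool)
                (uniform : KWiseUniformGen 4 m G) (3≤n : 3 ℕ.≤ n) where

  _≟ᵥ_ : (u v : BitStr n) → Dec (u ≡ v)
  _≟ᵥ_ = Vecₚ.≡-dec _≟ᵇ_

  open import Data.Vec.Membership.DecPropositional _≟ᵥ_ using (_∈?_)

  unique₃ : ∀ {p t₁ t₂ : BitStr n} → p ≢ t₁ → p ≢ t₂ → t₁ ≢ t₂ → VecUnique (p ∷ t₁ ∷ t₂ ∷ [])
  unique₃ p≢t₁ p≢t₂ t₁≢t₂ =
    (p≢t₁ VecAll.∷ p≢t₂ VecAll.∷ VecAll.[]) VecAllPairs.∷ (t₁≢t₂ VecAll.∷ VecAll.[]) VecAllPairs.∷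
    VecAll.[] VecAllPairs.∷ VecAllPairs.[]

  unique-snoc : ∀ {p t₁ t₂ t : BitStr n} → VecUnique (p ∷ t₁ ∷ t₂ ∷ []) → p ≢ t → t₁ ≢ t → t₂ ≢ t →
                VecUnique (p ∷ t₁ ∷ t₂ ∷ t ∷ [])
  unique-snoc ((p≢t₁ VecAll.∷ p≢t₂ VecAll.∷ VecAll.[]) VecAllPairs.∷ (t₁≢t₂ VecAll.∷ VecAll.[]) VecAllPairs.∷ _)
              p≢t t₁≢t t₂≢t =
    (p≢t₁ VecAll.∷ p≢t₂ VecAll.∷ p≢t VecAll.∷ VecAll.[]) VecAllPairs.∷
    (t₁≢t₂ VecAll.∷ t₁≢t VecAll.∷ VecAll.[]) VecAllPairs.∷ (t₂≢t VecAll.∷ VecAll.[]) VecAllPairs.∷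
    VecAll.[] VecAllPairs.∷ VecAllPairs.[]

  pair-cover : ∀ {p a b} → a ≢ p → b ≢ p → Σ (Vec (BitStr n) 2) λ ts → VecUnique (p ∷ ts) × a ∈ ts × b ∈ ts
  pair-cover {p} {a} {b} a≢p b≢p with a ≟ᵥ b | avoid-three 3≤n a p p
  ... | yes refl | d , d≢a , d≢p , _ =
    a ∷ d ∷ [] , unique₃ (≢-sym a≢p) (≢-sym d≢p) (≢-sym d≢a) , here refl , here refl
  ... | no a≢b   | _ =
    a ∷ b ∷ [] , unique₃ (≢-sym a≢p) (≢-sym b≢p) a≢b , here refl , there (here refl)

  -- Fresh points complete a, b, c (which may coincide) to three coordinates distinct from each other
  -- and from p, so that four-wise uniformity applies to χ a * χ b * χ c * χ p.
  triple-cover : ∀ {p a b c} → a ≢ p → b ≢ p → c ≢ p →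
                 Σ (Vec (BitStr n) 3) λ ts → VecUnique (p ∷ ts) × a ∈ ts × b ∈ ts × c ∈ ts
  triple-cover {p} {a} {b} {c} a≢p b≢p c≢p with pair-cover a≢p b≢p
  ... | ts@(t₁ ∷ t₂ ∷ []) , u , a∈ , b∈ with c ∈? ts | avoid-three 3≤n t₁ t₂ p
  ...   | yes c∈ | d , d≢t₁ , d≢t₂ , d≢p =
    ts Vec.++ d ∷ [] , unique-snoc u (≢-sym d≢p) (≢-sym d≢t₁) (≢-sym d≢t₂) ,
    ∈-++⁺ˡ a∈ , ∈-++⁺ˡ b∈ , ∈-++⁺ˡ c∈
  ...   | no c∉   | _ =
    ts Vec.++ c ∷ [] , unique-snoc u (≢-sym c≢p) (λ t₁≡c → c∉ (here (sym t₁≡c))) (λ t₂≡c → c∉ (there (here (sym t₂≡c)))) ,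
    ∈-++⁺ˡ a∈ , ∈-++⁺ˡ b∈ , there (there (here refl))

  χ : BitStr m → BitStr n → ℚ
  χ s x = sign ⌊ G s x ≟ᵇ f x ⌋

  χ-square : ∀ s x → χ s x * χ s x ≡ 1ℚ
  χ-square s x = sign-square ⌊ G s x ≟ᵇ f x ⌋

  ∑ₛ : (BitStr m → ℚ) → ℚ
  ∑ₛ = ∑ (allBitStr m)

  χ-product-vanishes : ∀ {a b c p} → a ≢ p → b ≢ p → c ≢ p → ∑ₛ (λ s → χ s a * χ s b * χ s c * χ s p) ≡ 0ℚ
  χ-product-vanishes {a} {b} {c} {p} a≢p b≢p c≢p with triple-cover a≢p b≢p c≢p
  ... | ts , u , a∈ , b∈ , c∈ =
    trans (∑-cong (allBitStr m) (λ s → cong₂ _*_ (cong₂ _*_ (cong₂ _*_ (χ-at s a∈) (χ-at s b∈)) (χ-at s c∈)) refl))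
          (parity-vanishes G uniform (lookup (p ∷ ts)) (lookup-injective u _ _) Ψ (f p))
    where
    Ψ : BitStr 3 → ℚ
    Ψ y = sign ⌊ lookup y (index a∈) ≟ᵇ f a ⌋ * sign ⌊ lookup y (index b∈) ≟ᵇ f b ⌋
          * sign ⌊ lookup y (index c∈) ≟ᵇ f c ⌋
    χ-at : ∀ s {x} (x∈ : x ∈ ts) → χ s x ≡ sign ⌊ lookup (tabulate (G s ∘ lookup ts)) (index x∈) ≟ᵇ f x ⌋
    χ-at s {x} x∈ = cong (λ y → sign ⌊ y ≟ᵇ f x ⌋)
      (sym (trans (Vecₚ.lookup∘tabulate (G s ∘ lookup ts) (index x∈)) (cong (G s) (sym (lookup-index x∈)))))

  ∑ₛ-const : ∀ c → ∑ₛ (λ _ → c) ≡ fromℕ (2 ^ m) * c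
  ∑ₛ-const c = trans (∑-const (allBitStr m) c) (cong (λ k → fromℕ k * c) (length-allBitStr m))

  ∑ₛ-*ˡ-vanishes : ∀ c {F : BitStr m → ℚ} → ∑ₛ F ≡ 0ℚ → ∑ₛ (λ s → c * F s) ≡ 0ℚ
  ∑ₛ-*ˡ-vanishes c {F} ∑F≡0 = trans (∑-*ˡ (allBitStr m) c F) (trans (cong (c *_) ∑F≡0) (ℚP.*-zeroʳ c))

  ∑ₛ-∑-vanishes : ∀ {A : Set} (L : List A) (c : A → ℚ) (F : BitStr m → A → ℚ) →
                  All (λ a → ∑ₛ (λ s → F s a) ≡ 0ℚ) L → ∑ₛ (λ s → ∑[ a ∈ L ] (c a * F s a)) ≡ 0ℚ
  ∑ₛ-∑-vanishes L c F vanish = begin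
    ∑ₛ (λ s → ∑[ a ∈ L ] (c a * F s a))   ≡⟨ ∑-comm (allBitStr m) L _ ⟩
    ∑[ a ∈ L ] ∑ₛ (λ s → c a * F s a)     ≡⟨ ∑-cong-All L (All.map (λ {a} → ∑ₛ-*ˡ-vanishes (c a)) vanish) ⟩
    ∑[ a ∈ L ] 0ℚ                          ≡⟨ ∑-zero L ⟩
    0ℚ                                     ∎
    where open ≡-Reasoning

  module Moments (h : BitStr n → ℚ) where

    correlation : List (BitStr n) → BitStr m → ℚ
    correlation L s = ∑[ x ∈ L ] (h x * χ s x)

    χ-cube : ∀ s x q → χ s x * q ≡ χ s x * χ s x * χ s x * q
    χ-cube s x q = cong (_* q) (sym (trans (cong (_* χ s x) (χ-square s x)) (ℚP.*-identityˡ (χ s x))))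

    correlation-χ-vanishes : ∀ L p → All (_≢ p) L → ∑ₛ (λ s → correlation L s * χ s p) ≡ 0ℚ
    correlation-χ-vanishes L p L∌p = begin
      ∑ₛ (λ s → correlation L s * χ s p)
        ≡⟨ ∑-cong (allBitStr m) (λ s → trans (∑-*ʳ L _ (χ s p)) (∑-cong L (λ x → ℚP.*-assoc (h x) (χ s x) (χ s p)))) ⟩
      ∑ₛ (λ s → ∑[ x ∈ L ] (h x * (χ s x * χ s p)))
        ≡⟨ ∑ₛ-∑-vanishes L h _ (All.map (λ x≢p → trans (∑-cong (allBitStr m) (λ s → χ-cube s _ _))
                                                      (χ-product-vanishes x≢p x≢p x≢p)) L∌p) ⟩
      0ℚ ∎
      where open ≡-Reasoning

    correlation³-χ-vanishes : ∀ L p → All (_≢ p) L →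
      ∑ₛ (λ s → correlation L s * correlation L s * correlation L s * χ s p) ≡ 0ℚ
    correlation³-χ-vanishes L p L∌p = begin
      ∑ₛ (λ s → correlation L s * correlation L s * correlation L s * χ s p)
        ≡⟨ ∑-cong (allBitStr m) (λ s → trans (∑-cube L (λ x → h x * χ s x) (χ s p))
             (∑-cong L (λ a → ∑-cong L (λ b → ∑-cong L (λ c → regroup (h a) (h b) (h c) (χ s a) (χ s b) (χ s c) (χ s p)))))) ⟩
      ∑ₛ (λ s → ∑[ a ∈ L ] ∑[ b ∈ L ] ∑[ c ∈ L ] (h a * (h b * (h c * (χ s a * χ s b * χ s c * χ s p)))))
        ≡⟨ ∑-cong (allBitStr m) (λ s → ∑-cong L (λ a →
             trans (∑-cong L (λ b → trans (∑-*ˡ L (h a) _) (cong (h a *_) (∑-*ˡ L (h b) _)))) (∑-*ˡ L (h a) _))) ⟩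
      ∑ₛ (λ s → ∑[ a ∈ L ] (h a * ∑[ b ∈ L ] (h b * ∑[ c ∈ L ] (h c * (χ s a * χ s b * χ s c * χ s p)))))
        ≡⟨ ∑ₛ-∑-vanishes L h _ (All.map (λ a≢p →
             ∑ₛ-∑-vanishes L h _ (All.map (λ b≢p →
               ∑ₛ-∑-vanishes L h _ (All.map (λ c≢p → χ-product-vanishes a≢p b≢p c≢p) L∌p)) L∌p)) L∌p) ⟩
      0ℚ ∎
      where
      open ≡-Reasoning
      regroup : ∀ ha hb hc xa xb xc xp →
                ha * xa * (hb * xb) * (hc * xc) * xp ≡ ha * (hb * (hc * (xa * xb * xc * xp)))
      regroup = solve-∀ ℚ-ring

    sq-mass : List (BitStr n) → ℚ
    sq-mass L = ∑[ x ∈ L ] (h x * h x)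

    -- Adding x ∉ L to the block, every term odd in χ x vanishes by χ-product-vanishes.
    second-moment : ∀ L → Unique L → ∑ₛ (λ s → correlation L s * correlation L s) ≡ fromℕ (2 ^ m) * sq-mass L
    second-moment []      _               = trans (∑-zero (allBitStr m)) (sym (ℚP.*-zeroʳ (fromℕ (2 ^ m))))
    second-moment (x ∷ L) (x∉L AllPairs.∷ L!) = begin
      ∑ₛ (λ s → (h x * χ s x + Y s) * (h x * χ s x + Y s))
        ≡⟨ ∑-cong (allBitStr m) (λ s → square-expansion (h x) (χ s x) (Y s) (χ-square s x)) ⟩
      ∑ₛ (λ s → h x * h x + two * h x * (Y s * χ s x) + Y s * Y s)
        ≡⟨ trans (∑-+ (allBitStr m) _ _) (cong (_+ ∑ₛ (λ s → Y s * Y s)) (∑-+ (allBitStr m) _ _)) ⟩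
      ∑ₛ (λ _ → h x * h x) + ∑ₛ (λ s → two * h x * (Y s * χ s x)) + ∑ₛ (λ s → Y s * Y s)
        ≡⟨ cong₂ _+_ (cong₂ _+_ (∑ₛ-const (h x * h x)) (∑ₛ-*ˡ-vanishes (two * h x) (correlation-χ-vanishes L x L∌x)))
                     (second-moment L L!) ⟩
      N * (h x * h x) + 0ℚ + N * sq-mass L
        ≡⟨ collect N (h x * h x) (sq-mass L) ⟩
      N * (h x * h x + sq-mass L) ∎
      where
      open ≡-Reasoning
      N = fromℕ (2 ^ m)
      two = fromℕ 2
      Y = correlation L
      L∌x = All.map ≢-sym x∉L
      collect : ∀ N a b → N * a + 0ℚ + N * b ≡ N * (a + b)
      collect = solve-∀ ℚ-ring

    fourth-moment-≤ : ∀ L → Unique L →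
      ∑ₛ (λ s → (correlation L s * correlation L s) * (correlation L s * correlation L s))
        ≤ fromℕ 3 * fromℕ (2 ^ m) * (sq-mass L * sq-mass L)
    fourth-moment-≤ []      _               =
      ℚP.≤-reflexive (trans (∑-zero (allBitStr m)) (sym (ℚP.*-zeroʳ (fromℕ 3 * fromℕ (2 ^ m)))))
    fourth-moment-≤ (x ∷ L) (x∉L AllPairs.∷ L!) = begin
      ∑ₛ (λ s → (h x * χ s x + Y s) * (h x * χ s x + Y s) * ((h x * χ s x + Y s) * (h x * χ s x + Y s)))
        ≡⟨ ∑-cong (allBitStr m) (λ s → fourth-power-expansion (h x) (χ s x) (Y s) (χ-square s x)) ⟩
      ∑ₛ (λ s → t₀ s + t₁ s + t₂ s + t₃ s + Y⁴ s)
        ≡⟨ split t₀ t₁ t₂ t₃ Y⁴ ⟩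
      ∑ₛ t₀ + ∑ₛ t₁ + ∑ₛ t₂ + ∑ₛ t₃ + ∑ₛ Y⁴
        ≡⟨ cong (_+ ∑ₛ Y⁴) (cong₂ _+_ (cong₂ _+_ (cong₂ _+_
             (∑ₛ-const (a² * a²))
             (∑ₛ-*ˡ-vanishes (four * a³) (correlation-χ-vanishes L x L∌x)))
             (trans (∑-*ˡ (allBitStr m) (six * a²) _) (cong (six * a² *_) (second-moment L L!))))
             (∑ₛ-*ˡ-vanishes (four * h x) (correlation³-χ-vanishes L x L∌x))) ⟩
      N * (a² * a²) + 0ℚ + six * a² * (N * S) + 0ℚ + ∑ₛ Y⁴
        ≤⟨ ℚP.+-monoʳ-≤ (N * (a² * a²) + 0ℚ + six * a² * (N * S) + 0ℚ) (fourth-moment-≤ L L!) ⟩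
      N * (a² * a²) + 0ℚ + six * a² * (N * S) + 0ℚ + three * N * (S * S)
        ≤⟨ ≤-+-nonneg (*-nonneg (*-nonneg (fromℕ-nonneg 2) (fromℕ-nonneg (2 ^ m))) (square-nonneg a²)) ⟩
      N * (a² * a²) + 0ℚ + six * a² * (N * S) + 0ℚ + three * N * (S * S) + fromℕ 2 * N * (a² * a²)
        ≡⟨ collect N a² S ⟩
      three * N * ((a² + S) * (a² + S)) ∎
      where
      open ℚP.≤-Reasoning
      N = fromℕ (2 ^ m)
      three = fromℕ 3
      four = fromℕ 4
      six = fromℕ 6
      Y = correlation L
      S = sq-mass L
      L∌x = All.map ≢-sym x∉L
      a² = h x * h x
      a³ = h x * h x * h x
      t₀ t₁ t₂ t₃ Y⁴ : BitStr m → ℚ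
      t₀ _ = a² * a²
      t₁ s = four * a³ * (Y s * χ s x)
      t₂ s = six * a² * (Y s * Y s)
      t₃ s = four * h x * (Y s * Y s * Y s * χ s x)
      Y⁴ s = (Y s * Y s) * (Y s * Y s)
      split : ∀ t₀ t₁ t₂ t₃ t₄ →
              ∑ₛ (λ s → t₀ s + t₁ s + t₂ s + t₃ s + t₄ s) ≡ ∑ₛ t₀ + ∑ₛ t₁ + ∑ₛ t₂ + ∑ₛ t₃ + ∑ₛ t₄
      split t₀ t₁ t₂ t₃ t₄ =
        trans (∑-+ (allBitStr m) _ t₄) (cong (_+ ∑ₛ t₄)
        (trans (∑-+ (allBitStr m) _ t₃) (cong (_+ ∑ₛ t₃)
        (trans (∑-+ (allBitStr m) _ t₂) (cong (_+ ∑ₛ t₂) (∑-+ (allBitStr m) t₀ t₁))))))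
      collect : ∀ N a S →
        N * (a * a) + 0ℚ + six * a * (N * S) + 0ℚ + three * N * (S * S) + fromℕ 2 * N * (a * a)
          ≡ three * N * ((a + S) * (a + S))
      collect = solve-∀ ℚ-ring

    abs-correlation-sum : List (BitStr n) → ℚ
    abs-correlation-sum L = ∑ₛ (λ s → ∣ correlation L s ∣)

    block-first-moment : ∀ L → Unique L →
      fromℕ (2 ^ m) * fromℕ (2 ^ m) * (∑ L h * ∑ L h)
        ≤ fromℕ (length L) * fromℕ 3 * (abs-correlation-sum L * abs-correlation-sum L)
    block-first-moment L L! = begin
      N * N * (∑ L h * ∑ L h)                  ≤⟨ *-monoˡ-≤ (*-nonneg 0≤N 0≤N) mass²≤ ⟩
      N * N * (fromℕ (length L) * sq-mass L)   ≡⟨ regroup N (fromℕ (length L)) (sq-mass L) ⟩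
      fromℕ (length L) * (N * N * sq-mass L)   ≤⟨ *-monoˡ-≤ (fromℕ-nonneg (length L))
                                                     (first-moment-bound (allBitStr m) (correlation L) N (sq-mass L) (fromℕ 3)
                                                        0<N (fromℕ-nonneg 3) (second-moment L L!) (fourth-moment-≤ L L!)) ⟩
      fromℕ (length L) * (fromℕ 3 * (E * E))  ≡⟨ ℚP.*-assoc (fromℕ (length L)) (fromℕ 3) (E * E) ⟨
      fromℕ (length L) * fromℕ 3 * (E * E)    ∎
      where
      open ℚP.≤-Reasoning
      N = fromℕ (2 ^ m)
      0<N = fromℕ-mono-< {0} (ℕP.m^n>0 2 m)
      0≤N = ℚP.<⇒≤ 0<N
      E = abs-correlation-sum L
      regroup : ∀ N b z → N * N * (b * z) ≡ b * (N * N * z)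
      regroup = solve-∀ ℚ-ring
      mass²≤ : ∑ L h * ∑ L h ≤ fromℕ (length L) * sq-mass L
      mass²≤ = subst (λ z → ∑ L h * ∑ L h ≤ z * sq-mass L) (trans (∑-const L 1ℚ) (ℚP.*-identityʳ (fromℕ (length L))))
                 (cauchy-schwarz L (λ _ → 1ℚ) (λ x → h x * h x) h (λ _ → ℚP.<⇒≤ (ℚP.positive⁻¹ 1ℚ))
                   (λ x → square-nonneg (h x)) (λ x → ℚP.≤-reflexive (sym (ℚP.*-identityˡ (h x * h x)))))

    -- Per block N · H(B j) ≤ (3b)^½ · ∑ₛ |X (B j)|; summing and using 12γ²b ≤ 1 gives
    -- 2γN ≤ ∑ₛ ∑ⱼ |X (B j)|, and some seed reaches the average.
    good-seed : ∀ {J : Set} (I : List J) (B : J → List (BitStr n)) (b : ℕ) (γ : ℚ) →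
      (∀ j → Unique (B j)) → (∀ j → length (B j) ≡ b) → ∑[ j ∈ I ] ∑ (B j) h ≡ 1ℚ →
      fromℕ 12 * (γ * γ) * fromℕ b ≤ 1ℚ →
      Σ (BitStr m) λ s → fromℕ 2 * γ ≤ ∑[ j ∈ I ] ∣ correlation (B j) s ∣
    good-seed I B b γ B! |B|≡b total-mass small =
      average-attained (allBitStr m) (λ s → ∑[ j ∈ I ] ∣ correlation (B j) s ∣) (fromℕ 2 * γ)
        (subst (0 ℕ.<_) (sym (length-allBitStr m)) (ℕP.m^n>0 2 m))
        (subst₂ _≤_ (trans (ℚP.*-comm (fromℕ 2 * γ) N) (cong (λ c → fromℕ c * (fromℕ 2 * γ)) (sym (length-allBitStr m))))
                    (∑-comm I (allBitStr m) (λ j s → ∣ correlation (B j) s ∣))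
                    2γN≤Se)
      where
      open ℚP.≤-Reasoning
      N = fromℕ (2 ^ m)
      0<N = fromℕ-mono-< {0} (ℕP.m^n>0 2 m)
      E : _ → ℚ
      E j = abs-correlation-sum (B j)
      0≤E : ∀ j → 0ℚ ≤ E j
      0≤E j = ∑-nonneg (allBitStr m) (λ s → ℚP.0≤∣p∣ (correlation (B j) s))
      Se = ∑ I E
      b3 = fromℕ b * fromℕ 3
      per-block : ∀ j → N * N * (∑ (B j) h * ∑ (B j) h) ≤ b3 * (E j * E j)
      per-block j = subst (λ c → N * N * (∑ (B j) h * ∑ (B j) h) ≤ fromℕ c * fromℕ 3 * (E j * E j))
                          (|B|≡b j) (block-first-moment (B j) (B! j))
      N²≤ : N * N ≤ b3 * (Se * Se)
      N²≤ = subst (_≤ b3 * (Se * Se)) (trans (cong (λ t → N * N * (t * t)) total-mass) (ℚP.*-identityʳ (N * N)))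
              (∑-≤-from-squares I (N * N) b3 (λ j → ∑ (B j) h) E (*-pos 0<N 0<N)
                 (*-nonneg (fromℕ-nonneg b) (fromℕ-nonneg 3)) 0≤E per-block)
      regroup₁ : ∀ γ N → fromℕ 2 * γ * N * (fromℕ 2 * γ * N) ≡ fromℕ 4 * (γ * γ) * (N * N)
      regroup₁ = solve-∀ ℚ-ring
      regroup₂ : ∀ γ b S → fromℕ 4 * (γ * γ) * (b * fromℕ 3 * (S * S)) ≡ fromℕ 12 * (γ * γ) * b * (S * S)
      regroup₂ = solve-∀ ℚ-ring
      2γN≤Se : fromℕ 2 * γ * N ≤ Se
      2γN≤Se = ≤-from-squares (∑-nonneg I 0≤E) (begin
        fromℕ 2 * γ * N * (fromℕ 2 * γ * N)     ≡⟨ regroup₁ γ N ⟩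
        fromℕ 4 * (γ * γ) * (N * N)             ≤⟨ *-monoˡ-≤ (*-nonneg (fromℕ-nonneg 4) (square-nonneg γ)) N²≤ ⟩
        fromℕ 4 * (γ * γ) * (b3 * (Se * Se))    ≡⟨ regroup₂ γ (fromℕ b) Se ⟩
        fromℕ 12 * (γ * γ) * fromℕ b * (Se * Se) ≤⟨ *-monoʳ-≤ (square-nonneg Se) small ⟩
        1ℚ * (Se * Se)                          ≡⟨ ℚP.*-identityˡ (Se * Se) ⟩
        Se * Se                                 ∎)

-- Agreement of corrected generators

½ : ℚ
½ = ℤ.+ 1 / 2

agreement : ∀ {n} → Distribution n → (BitStr n → Bool) → (BitStr n → Bool) → ℚ
agreement {n} H g f = ∑[ x ∈ allBitStr n ] (if ⌊ g x ≟ᵇ f x ⌋ then Distribution.weight H x else 0ℚ)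

agreement-cong : ∀ {n} (H : Distribution n) {g g′} f → (∀ x → g x ≡ g′ x) → agreement H g f ≡ agreement H g′ f
agreement-cong {n} H f g≗g′ = ∑-cong (allBitStr n) (λ x → cong (λ b → if ⌊ b ≟ᵇ f x ⌋ then _ else 0ℚ) (g≗g′ x))

agreement-self : ∀ {n} (H : Distribution n) f → agreement H f f ≡ 1ℚ
agreement-self {n} H f =
  trans (∑-cong (allBitStr n) (λ x → cong (λ d → if ⌊ d ⌋ then _ else 0ℚ) (≡-≟-identity _≟ᵇ_ (refl {x = f x}))))
        (Distribution.sums-to-1 H)

indicator-as-sign : ∀ c w → (if c then w else 0ℚ) ≡ ½ * (w + sign c * w)
indicator-as-sign true  = half-sum
  where
  half-sum : ∀ w → w ≡ ½ * (w + 1ℚ * w)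
  half-sum = solve-∀ ℚ-ring
indicator-as-sign false = half-difference
  where
  half-difference : ∀ w → 0ℚ ≡ ½ * (w + ℚ.- 1ℚ * w)
  half-difference = solve-∀ ℚ-ring

sign-xor : ∀ g f σ → sign ⌊ (g xor σ) ≟ᵇ f ⌋ ≡ sign (not σ) * sign ⌊ g ≟ᵇ f ⌋
sign-xor false false false = refl
sign-xor false false true  = refl
sign-xor false true  false = refl
sign-xor false true  true  = refl
sign-xor true  false false = refl
sign-xor true  false true  = refl
sign-xor true  true  false = refl
sign-xor true  true  true  = refl

agreement-term : ∀ g f σ w →
                 (if ⌊ (g xor σ) ≟ᵇ f ⌋ then w else 0ℚ) ≡ ½ * (w + sign (not σ) * (w * sign ⌊ g ≟ᵇ f ⌋))
agreement-term g f σ w = trans (indicator-as-sign _ w)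
  (cong (λ t → ½ * (w + t)) (trans (cong (_* w) (sign-xor g f σ)) (regroup (sign (not σ)) (sign ⌊ g ≟ᵇ f ⌋) w)))
  where
  regroup : ∀ a b w → a * b * w ≡ a * (w * b)
  regroup = solve-∀ ℚ-ring

negative? : ℚ → Bool
negative? y = ⌊ y ℚP.<? 0ℚ ⌋

sign-negative? : ∀ y → sign (not (negative? y)) * y ≡ ∣ y ∣
sign-negative? y with y ℚP.<? 0ℚ
... | no  y≮0 = trans (ℚP.*-identityˡ y) (sym (ℚP.0≤p⇒∣p∣≡p (ℚP.≮⇒≥ y≮0)))
... | yes y<0 with ℚP.∣p∣≡p∨∣p∣≡-p y
...   | inj₁ ∣y∣≡y  = ⊥-elim (ℚP.<-irrefl refl (ℚP.<-≤-trans y<0 (ℚP.∣p∣≡p⇒0≤p ∣y∣≡y)))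
...   | inj₂ ∣y∣≡-y = trans (negate y) (sym ∣y∣≡-y)
  where
  negate : ∀ y → ℚ.- 1ℚ * y ≡ ℚ.- y
  negate = solve-∀ ℚ-ring

take-++ : ∀ {A : Set} k {l} (β : Vec A k) (y : Vec A l) → take k (β Vec.++ y) ≡ β
take-++ k β y = Vecₚ.++-injectiveˡ (take k (β Vec.++ y)) β (Vecₚ.take++drop≡id k (β Vec.++ y))

Correction : ∀ {k l m} → Distribution (k ℕ.+ l) → (BitStr (k ℕ.+ l) → Bool) →
             (BitStr m → BitStr (k ℕ.+ l) → Bool) → ℚ → Set
Correction {k} {l} {m} H f G γ =
  Σ (BitStr m) λ s → Σ (BitStr k → Bool) λ σ → ½ + γ ≤ agreement H (λ x → G s x xor σ (take k x)) f

module BlockCorrection {k l m : ℕ} (f : BitStr (k ℕ.+ l) → Bool) (G : BitStr m → BitStr (k ℕ.+ l) → Bool)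
                       (uniform : KWiseUniformGen 4 m G) (3≤n : 3 ℕ.≤ k ℕ.+ l) (H : Distribution (k ℕ.+ l)) where

  open FourWise f G uniform 3≤n
  h = Distribution.weight H
  open Moments h

  block : BitStr k → List (BitStr (k ℕ.+ l))
  block β = map (β Vec.++_) (allBitStr l)

  ∑-blocks : ∀ F → ∑ (allBitStr (k ℕ.+ l)) F ≡ ∑[ β ∈ allBitStr k ] ∑ (block β) F
  ∑-blocks F = trans (∑-allBitStr-++ k l F) (∑-cong (allBitStr k) (λ β → sym (∑-map (allBitStr l) (β Vec.++_) F)))

  block-unique : ∀ β → Unique (block β)
  block-unique β = Uniqueₚ.map⁺ (Vecₚ.++-injectiveʳ β β) (allBitStr-unique l)

  block-length : ∀ β → length (block β) ≡ 2 ^ l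
  block-length β = trans (Listₚ.length-map (β Vec.++_) (allBitStr l)) (length-allBitStr l)

  ∑-block-take : ∀ β (F : BitStr k → BitStr (k ℕ.+ l) → ℚ) →
                 ∑[ x ∈ block β ] F (take k x) x ≡ ∑[ x ∈ block β ] F β x
  ∑-block-take β F = begin
    ∑[ x ∈ block β ] F (take k x) x                               ≡⟨ ∑-map (allBitStr l) (β Vec.++_) _ ⟩
    ∑[ y ∈ allBitStr l ] F (take k (β Vec.++ y)) (β Vec.++ y)     ≡⟨ ∑-cong (allBitStr l) (λ y → cong (λ γ → F γ (β Vec.++ y)) (take-++ k β y)) ⟩
    ∑[ y ∈ allBitStr l ] F β (β Vec.++ y)                         ≡⟨ ∑-map (allBitStr l) (β Vec.++_) _ ⟨
    ∑[ x ∈ block β ] F β x                                        ∎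
    where open ≡-Reasoning

  total-mass : ∑[ β ∈ allBitStr k ] ∑ (block β) h ≡ 1ℚ
  total-mass = trans (sym (∑-blocks h)) (Distribution.sums-to-1 H)

  agreement-correction : ∀ s (σ : BitStr k → Bool) →
    agreement H (λ x → G s x xor σ (take k x)) f
      ≡ ½ * (1ℚ + ∑[ β ∈ allBitStr k ] (sign (not (σ β)) * correlation (block β) s))
  agreement-correction s σ = begin
    agreement H (λ x → G s x xor σ (take k x)) f
      ≡⟨ ∑-blocks _ ⟩
    ∑[ β ∈ allBitStr k ] ∑[ x ∈ block β ] indicator (σ (take k x)) x
      ≡⟨ ∑-cong (allBitStr k) per-block ⟩
    ∑[ β ∈ allBitStr k ] (½ * (∑ (block β) h + sign (not (σ β)) * correlation (block β) s))
      ≡⟨ trans (∑-*ˡ (allBitStr k) ½ _) (cong (½ *_) (∑-+ (allBitStr k) _ _)) ⟩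
    ½ * (∑[ β ∈ allBitStr k ] ∑ (block β) h + ∑[ β ∈ allBitStr k ] (sign (not (σ β)) * correlation (block β) s))
      ≡⟨ cong (λ t → ½ * (t + ∑[ β ∈ allBitStr k ] (sign (not (σ β)) * correlation (block β) s))) total-mass ⟩
    ½ * (1ℚ + ∑[ β ∈ allBitStr k ] (sign (not (σ β)) * correlation (block β) s)) ∎
    where
    open ≡-Reasoning
    indicator : Bool → BitStr (k ℕ.+ l) → ℚ
    indicator b x = if ⌊ G s x xor b ≟ᵇ f x ⌋ then h x else 0ℚ
    per-block : ∀ β → ∑[ x ∈ block β ] indicator (σ (take k x)) x
                      ≡ ½ * (∑ (block β) h + sign (not (σ β)) * correlation (block β) s)
    per-block β = begin
      ∑[ x ∈ block β ] indicator (σ (take k x)) x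
        ≡⟨ ∑-block-take β (λ β′ → indicator (σ β′)) ⟩
      ∑[ x ∈ block β ] indicator (σ β) x
        ≡⟨ ∑-cong (block β) (λ x → agreement-term (G s x) (f x) (σ β) (h x)) ⟩
      ∑[ x ∈ block β ] (½ * (h x + sign (not (σ β)) * (h x * χ s x)))
        ≡⟨ ∑-*ˡ (block β) ½ _ ⟩
      ½ * ∑[ x ∈ block β ] (h x + sign (not (σ β)) * (h x * χ s x))
        ≡⟨ cong (½ *_) (trans (∑-+ (block β) h _) (cong (∑ (block β) h +_) (∑-*ˡ (block β) (sign (not (σ β))) (λ x → h x * χ s x)))) ⟩
      ½ * (∑ (block β) h + sign (not (σ β)) * correlation (block β) s) ∎

  block-correction : ∀ γ → fromℕ 12 * (γ * γ) * fromℕ (2 ^ l) ≤ 1ℚ → Correction H f G γ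
  block-correction γ small = s , σ , ℚP.≤-trans lower-bound (ℚP.≤-reflexive (sym exact))
    where
    seed = good-seed (allBitStr k) block (2 ^ l) γ block-unique block-length total-mass small
    s = proj₁ seed
    X : BitStr k → ℚ
    X β = correlation (block β) s
    σ : BitStr k → Bool
    σ β = negative? (X β)
    halve : ∀ γ → ½ + γ ≡ ½ * (1ℚ + fromℕ 2 * γ)
    halve = solve-∀ ℚ-ring
    lower-bound : ½ + γ ≤ ½ * (1ℚ + ∑[ β ∈ allBitStr k ] ∣ X β ∣)
    lower-bound = ℚP.≤-trans (ℚP.≤-reflexive (halve γ))
                    (*-monoˡ-≤ (ℚP.<⇒≤ (ℚP.positive⁻¹ ½)) (ℚP.+-monoʳ-≤ 1ℚ (proj₂ seed)))
    exact : agreement H (λ x → G s x xor σ (take k x)) f ≡ ½ * (1ℚ + ∑[ β ∈ allBitStr k ] ∣ X β ∣)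
    exact = trans (agreement-correction s σ)
                  (cong (λ t → ½ * (1ℚ + t)) (∑-cong (allBitStr k) (λ β → sign-negative? (X β))))

exact-correction : ∀ {k m} (H : Distribution (k ℕ.+ 0)) f (G : BitStr m → BitStr (k ℕ.+ 0) → Bool) γ →
                   γ ≤ ½ → Correction H f G γ
exact-correction {k} {m} H f G γ γ≤½ = s , σ , (begin
  ½ + γ                                          ≤⟨ ℚP.+-monoʳ-≤ ½ γ≤½ ⟩
  1ℚ                                             ≡⟨ agreement-self H f ⟨
  agreement H f f                                ≡⟨ agreement-cong H f corrects ⟨
  agreement H (λ x → G s x xor σ (take k x)) f   ∎)
  where
  open ℚP.≤-Reasoning
  s = Vec.replicate m false
  σ : BitStr k → Bool
  σ β = G s (β Vec.++ []) xor f (β Vec.++ [])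
  restore : ∀ x → take k x Vec.++ [] ≡ x
  restore x = trans (cong (take k x Vec.++_) (empty (drop k x))) (Vecₚ.take++drop≡id k x)
    where
    empty : (v : BitStr 0) → [] ≡ v
    empty [] = refl
  corrects : ∀ x → G s x xor σ (take k x) ≡ f x
  corrects x = trans (cong (λ z → G s x xor (G s z xor f z)) (restore x))
                     (trans (sym (xor-assoc (G s x) (G s x) (f x))) (cong (_xor f x) (xor-same (G s x))))

-- Circuits for arbitrary functions of a prefix

-- tables q = 2^(2^q) counts the truth tables on q bits; each table on q + 1 bits is a 3-gate
-- multiplexer of two tables on q bits. mux-cost p = 3 (2^p − 1) selects among 2^p functions.
tables : ℕ → ℕ
tables zero    = 2
tables (suc q) = tables q ℕ.* tables q

tables-cost : ℕ → ℕ
tables-cost zero    = 2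
tables-cost (suc q) = tables-cost q ℕ.+ 3 ℕ.* (tables q ℕ.* tables q)

mux-cost : ℕ → ℕ
mux-cost zero    = 0
mux-cost (suc p) = mux-cost p ℕ.+ (mux-cost p ℕ.+ 3)

Table : ℕ → Set
Table zero    = Bool
Table (suc q) = Table q × Table q

evalTable : ∀ {q} → Table q → Vec Bool q → Bool
evalTable {zero}  b         []       = b
evalTable {suc q} (t₀ , t₁) (b ∷ bs) = if b then evalTable t₁ bs else evalTable t₀ bs

tableOf : ∀ {q} → (Vec Bool q → Bool) → Table q
tableOf {zero}  φ = φ []
tableOf {suc q} φ = tableOf (φ ∘ (false ∷_)) , tableOf (φ ∘ (true ∷_))

evalTable-tableOf : ∀ {q} (φ : Vec Bool q → Bool) v → evalTable (tableOf φ) v ≡ φ v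
evalTable-tableOf {zero}  φ []          = refl
evalTable-tableOf {suc q} φ (false ∷ v) = evalTable-tableOf (φ ∘ (false ∷_)) v
evalTable-tableOf {suc q} φ (true ∷ v)  = evalTable-tableOf (φ ∘ (true ∷_)) v

module Construction (n : ℕ) where

  Fn : Set
  Fn = BitStr n → Bool

  record Computed {k} (gs : Gates n k) (g : Fn) : Set where
    constructor wire
    field
      position : Fin (k ℕ.+ n)
      correct  : ∀ x → lookup (wires gs x) position ≡ g x

  AllComputed : ∀ {k} {J : Set} → Gates n k → (J → Fn) → Set
  AllComputed gs Q = ∀ j → Computed gs (Q j)

  _⊑_ : ∀ {k k′} → Gates n k → Gates n k′ → Set
  gs ⊑ gs′ = ∀ {g} → Computed gs g → Computed gs′ g

  Available : Fn → Set
  Available g = ∀ {k} (gs : Gates n k) → Computed gs g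

  record Extension {k} (gs : Gates n k) (c : ℕ) {J : Set} (Q : J → Fn) : Set where
    constructor extension
    field
      {size}   : ℕ
      gates    : Gates n size
      bounded  : size ℕ.≤ k ℕ.+ c
      extends  : gs ⊑ gates
      computes : AllComputed gates Q

  Extension₁ : ∀ {k} → Gates n k → ℕ → Fn → Set
  Extension₁ gs c g = Extension gs c {⊤} (λ _ → g)

  computed-cong : ∀ {k} {gs : Gates n k} {g g′} → (∀ x → g x ≡ g′ x) → Computed gs g → Computed gs g′
  computed-cong g≗g′ (wire i correct) = wire i (λ x → trans (correct x) (g≗g′ x))

  input : ∀ (i : Fin n) → Available (λ x → lookup x i)
  input i []       = wire i (λ x → refl)
  input i (gs ▷ g) = let wire j correct = input i gs in wire (suc j) correct

  add-gate : ∀ {k} (gs : Gates n k) (op : Bool → Bool → Bool) {g₁ g₂ : Fn} →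
             Computed gs g₁ → Computed gs g₂ → Extension₁ gs 1 (λ x → op (g₁ x) (g₂ x))
  add-gate {k} gs op (wire i correct₁) (wire j correct₂) =
    extension (gs ▷ gate op i j) (ℕP.≤-reflexive (ℕP.+-comm 1 k))
      (λ (wire a correct) → wire (suc a) correct) (λ _ → wire zero (λ x → cong₂ op (correct₁ x) (correct₂ x)))

  done : ∀ {k} (gs : Gates n k) {J : Set} {Q : J → Fn} → AllComputed gs Q → Extension gs 0 Q
  done {k} gs computes = extension gs (ℕP.≤-reflexive (sym (ℕP.+-identityʳ k))) (λ w → w) computes

  _>>=_ : ∀ {k c₁ c₂} {gs : Gates n k} {J₁ J₂ : Set} {Q₁ : J₁ → Fn} {Q₂ : J₂ → Fn} →
          Extension gs c₁ Q₁ → (∀ {k₁} (gs₁ : Gates n k₁) → gs ⊑ gs₁ → AllComputed gs₁ Q₁ → Extension gs₁ c₂ Q₂) →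
          Extension gs (c₁ ℕ.+ c₂) Q₂
  _>>=_ {k} {c₁} {c₂} (extension gs₁ bounded₁ extends₁ computes₁) next
    with next gs₁ extends₁ computes₁
  ... | extension gs₂ bounded₂ extends₂ computes₂ =
    extension gs₂ (ℕP.≤-trans bounded₂ (ℕP.≤-trans (ℕP.+-monoˡ-≤ c₂ bounded₁) (ℕP.≤-reflexive (ℕP.+-assoc k c₁ c₂))))
      (extends₂ ∘ extends₁) computes₂

  Covers : {J J′ : Set} → (J → Fn) → (J′ → Fn) → Set
  Covers {J} Q Q′ = ∀ j′ → Σ J λ j → ∀ x → Q j x ≡ Q′ j′ x

  weaken : ∀ {k c c′} {gs : Gates n k} {J J′ : Set} {Q : J → Fn} {Q′ : J′ → Fn} → c ℕ.≤ c′ →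
           Covers Q Q′ → Extension gs c Q → Extension gs c′ Q′
  weaken {k} c≤c′ covers (extension gs′ bounded extends computes) =
    extension gs′ (ℕP.≤-trans bounded (ℕP.+-monoʳ-≤ k c≤c′)) extends
      (λ j′ → let j , Qj≗Q′j′ = covers j′ in computed-cong Qj≗Q′j′ (computes j))

  mux : ∀ {k} (gs : Gates n k) {v a b : Fn} → Computed gs v → Computed gs a → Computed gs b →
        Extension₁ gs 3 (λ x → if v x then a x else b x)
  mux gs {v} {a} {b} cv ca cb =
    add-gate gs _∧_ cv ca >>= λ gs₁ ⊑₁ v∧a →
    add-gate gs₁ (λ u w → not u ∧ w) (⊑₁ cv) (⊑₁ cb) >>= λ gs₂ ⊑₂ ¬v∧b →
    weaken ℕP.≤-refl (λ _ → tt , λ x → select (v x) (a x) (b x)) (add-gate gs₂ _∨_ (⊑₂ (v∧a tt)) (¬v∧b tt))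
    where
    select : ∀ v a b → (v ∧ a) ∨ (not v ∧ b) ≡ (if v then a else b)
    select true  a b = ∨-identityʳ a
    select false a b = refl

  values : ∀ {q} → Vec Fn q → BitStr n → Vec Bool q
  values us x = Vec.map (λ u → u x) us

  for-each-table : ∀ q {k} (gs : Gates n k) (c : ℕ) {J : Table q → Set} {Q : (t : Table q) → J t → Fn} →
    (∀ t {k₁} (gs₁ : Gates n k₁) → gs ⊑ gs₁ → Extension gs₁ c (Q t)) →
    Extension gs (c ℕ.* tables q) (λ (tj : Σ (Table q) J) → Q (proj₁ tj) (proj₂ tj))
  for-each-table zero gs c {J} {Q} step =
    weaken (ℕP.≤-reflexive (sym (ℕP.*-comm c 2))) (λ j → j , λ x → refl)
      (step false gs (λ w → w) >>= λ gs₁ ⊑₁ out₁ →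
       step true gs₁ ⊑₁ >>= λ gs₂ ⊑₂ out₂ →
       done gs₂ {Q = λ (tj : Σ (Table zero) J) → Q (proj₁ tj) (proj₂ tj)}
         (λ { (false , j) → ⊑₂ (out₁ j) ; (true , j) → out₂ j }))
  for-each-table (suc q) gs c {J} {Q} step =
    weaken (ℕP.≤-reflexive (ℕP.*-assoc c (tables q) (tables q)))
      (λ { ((t₀ , t₁) , j) → (t₀ , (t₁ , j)) , λ x → refl })
      (for-each-table q gs (c ℕ.* tables q) {J = λ t₀ → Σ (Table q) (λ t₁ → J (t₀ , t₁))}
         {Q = λ t₀ t₁j → Q (t₀ , proj₁ t₁j) (proj₂ t₁j)}
         (λ t₀ gs₁ ⊑₁ → for-each-table q gs₁ c {J = λ t₁ → J (t₀ , t₁)} {Q = λ t₁ → Q (t₀ , t₁)}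
            (λ t₁ gs₂ ⊑₂ → step (t₀ , t₁) gs₂ (⊑₂ ∘ ⊑₁))))

  -- The constant tables are gates as well, so they need some computed wire g to read.
  all-tables : ∀ q (us : Vec Fn q) {k} (gs : Gates n k) {g : Fn} → Computed gs g → (∀ i → Computed gs (lookup us i)) →
               Extension gs (tables-cost q) (λ (t : Table q) x → evalTable t (values us x))
  all-tables zero [] gs cg cus =
    add-gate gs (λ _ _ → false) cg cg >>= λ gs₁ ⊑₁ out₁ →
    add-gate gs₁ (λ _ _ → true) (⊑₁ cg) (⊑₁ cg) >>= λ gs₂ ⊑₂ out₂ →
    done gs₂ {Q = λ (t : Table zero) x → evalTable t (values [] x)} (λ { false → ⊑₂ (out₁ tt) ; true → out₂ tt })
  all-tables (suc q) (u ∷ us) gs cg cus =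
    all-tables q us gs cg (cus ∘ suc) >>= λ gs₁ ⊑₁ out₁ →
    weaken ℕP.≤-refl (λ t → (t , tt) , λ x → refl)
      (for-each-table (suc q) gs₁ 3 {J = λ _ → ⊤} {Q = λ t _ x → evalTable t (values (u ∷ us) x)}
        (λ { (t₀ , t₁) gs₂ ⊑₂ → mux gs₂ (⊑₂ (⊑₁ (cus zero))) (⊑₂ (out₁ t₁)) (⊑₂ (out₁ t₀)) }))

  multiplexer : ∀ p (vs : Vec Fn p) (F : Vec Bool p → Fn) {k} (gs : Gates n k) →
                (∀ i → Computed gs (lookup vs i)) → (∀ β → Computed gs (F β)) →
                Extension₁ gs (mux-cost p) (λ x → F (values vs x) x)
  multiplexer zero [] F gs cvs cF = done gs (λ _ → cF [])
  multiplexer (suc p) (v ∷ vs) F gs cvs cF =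
    multiplexer p vs (F ∘ (false ∷_)) gs (cvs ∘ suc) (cF ∘ (false ∷_)) >>= λ gs₁ ⊑₁ out₁ →
    multiplexer p vs (F ∘ (true ∷_)) gs₁ (⊑₁ ∘ cvs ∘ suc) (⊑₁ ∘ cF ∘ (true ∷_)) >>= λ gs₂ ⊑₂ out₂ →
    weaken ℕP.≤-refl (λ _ → tt , λ x → if-η (v x) (λ b → F (b ∷ values vs x) x))
      (mux gs₂ (⊑₂ (⊑₁ (cvs zero))) (out₂ tt) (⊑₂ (out₁ tt)))
    where
    if-η : ∀ b (H : Bool → Bool) → (if b then H true else H false) ≡ H b
    if-η true  H = refl
    if-η false H = refl

  correction-circuit : ∀ p q (ws : Vec Fn (p ℕ.+ q)) → VecAll.All Available ws → (σ : Vec Bool (p ℕ.+ q) → Bool) →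
    (C : Circuit n) {g : Fn} → Computes C g →
    Σ (Circuit n) λ C′ → Circuit.size C′ ℕ.≤ Circuit.size C ℕ.+ (tables-cost q ℕ.+ (mux-cost p ℕ.+ 1)) ×
                         (∀ x → eval C′ x ≡ g x xor σ (values ws x))
  correction-circuit p q ws ws-available σ C {g} C-computes = package construction
    where
    open ≡-Reasoning
    gs = Circuit.gates C
    cg : Computed gs g
    cg = wire (Circuit.out C) C-computes
    hi = take p ws
    lo = drop p ws
    τ : Vec Bool p → Table q
    τ β = tableOf (λ v → σ (β Vec.++ v))
    lookup-table : ∀ x → evalTable (τ (values hi x)) (values lo x) ≡ σ (values ws x)
    lookup-table x = begin
      evalTable (τ (values hi x)) (values lo x)
        ≡⟨ evalTable-tableOf (λ v → σ (values hi x Vec.++ v)) (values lo x) ⟩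
      σ (values hi x Vec.++ values lo x)
        ≡⟨ cong₂ (λ u v → σ (u Vec.++ v)) (Vecₚ.take-map (λ u → u x) p ws) (Vecₚ.drop-map (λ u → u x) p ws) ⟨
      σ (take p (values ws x) Vec.++ drop p (values ws x))
        ≡⟨ cong σ (Vecₚ.take++drop≡id p (values ws x)) ⟩
      σ (values ws x) ∎
    construction : Extension₁ gs (tables-cost q ℕ.+ (mux-cost p ℕ.+ 1))
                     (λ x → g x xor evalTable (τ (values hi x)) (values lo x))
    construction =
      all-tables q lo gs cg (λ i → VecAllₚ.lookup⁺ (VecAllₚ.drop⁺ p ws-available) i gs) >>= λ gs₁ ⊑₁ tables →
      multiplexer p hi (λ β x → evalTable (τ β) (values lo x)) gs₁
        (λ i → VecAllₚ.lookup⁺ (VecAllₚ.take⁺ p ws-available) i gs₁) (λ β → tables (τ β)) >>= λ gs₂ ⊑₂ out →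
      add-gate gs₂ _xor_ (⊑₂ (⊑₁ cg)) (out tt)
    package : Extension₁ gs (tables-cost q ℕ.+ (mux-cost p ℕ.+ 1))
                (λ x → g x xor evalTable (τ (values hi x)) (values lo x)) →
              Σ (Circuit n) λ C′ → Circuit.size C′ ℕ.≤ Circuit.size C ℕ.+ (tables-cost q ℕ.+ (mux-cost p ℕ.+ 1)) ×
                                   (∀ x → eval C′ x ≡ g x xor σ (values ws x))
    package (extension gates bounded _ computes) =
      circuit _ gates (Computed.position (computes tt)) , bounded ,
      λ x → trans (Computed.correct (computes tt) x) (cong (g x xor_) (lookup-table x))

module _ (k l : ℕ) where
  open Construction (k ℕ.+ l)

  prefix-inputs : Σ (Vec Fn k) λ ws → VecAll.All Available ws × (∀ x → values ws x ≡ take k x)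
  prefix-inputs = ws , VecAllₚ.tabulate⁺ available ,
                  λ x → trans (sym (Vecₚ.tabulate-∘ (λ u → u x) bit)) (Vecₚ.tabulate∘lookup (take k x))
    where
    bit : Fin k → Fn
    bit i x = lookup (take k x) i
    ws = Vec.tabulate bit
    available : ∀ i → Available (bit i)
    available i gs = computed-cong (λ x → sym (Vecₚ.lookup-take-inject≤ x i)) (input _ gs)

-- Gate counts

tables≡ : ∀ q → tables q ≡ 2 ^ 2 ^ q
tables≡ zero    = refl
tables≡ (suc q) = begin
  tables q ℕ.* tables q        ≡⟨ cong₂ ℕ._*_ (tables≡ q) (tables≡ q) ⟩
  2 ^ 2 ^ q ℕ.* 2 ^ 2 ^ q      ≡⟨ ℕP.^-distribˡ-+-* 2 (2 ^ q) (2 ^ q) ⟨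
  2 ^ (2 ^ q ℕ.+ 2 ^ q)        ≡⟨ cong (λ e → 2 ^ (2 ^ q ℕ.+ e)) (ℕP.+-identityʳ (2 ^ q)) ⟨
  2 ^ 2 ^ suc q              ∎
  where open ≡-Reasoning

2≤tables : ∀ q → 2 ℕ.≤ tables q
2≤tables zero    = ℕP.≤-refl
2≤tables (suc q) = ℕP.≤-trans (2≤tables q) (ℕP.m≤m*n (tables q) (tables q) {{ℕ.>-nonZero (ℕP.≤-trans (s≤s z≤n) (2≤tables q))}})

tables-cost-≤ : ∀ q → tables-cost q ℕ.≤ 6 ℕ.* tables q
tables-cost-≤ zero    = ℕP.m≤m+n 2 10
tables-cost-≤ (suc q) = begin
  tables-cost q ℕ.+ 3 ℕ.* (t ℕ.* t)   ≤⟨ ℕP.+-monoˡ-≤ (3 ℕ.* (t ℕ.* t)) (tables-cost-≤ q) ⟩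
  6 ℕ.* t ℕ.+ 3 ℕ.* (t ℕ.* t)           ≤⟨ ℕP.+-monoˡ-≤ (3 ℕ.* (t ℕ.* t)) 6t≤3t² ⟩
  3 ℕ.* (t ℕ.* t) ℕ.+ 3 ℕ.* (t ℕ.* t)     ≡⟨ double (t ℕ.* t) ⟩
  6 ℕ.* (t ℕ.* t)                   ∎
  where
  open ℕP.≤-Reasoning
  t = tables q
  6t≤3t² : 6 ℕ.* t ℕ.≤ 3 ℕ.* (t ℕ.* t)
  6t≤3t² = ℕP.≤-trans (ℕP.≤-reflexive (ℕP.*-assoc 3 2 t)) (ℕP.*-monoʳ-≤ 3 (ℕP.*-monoˡ-≤ t (2≤tables q)))
  double : ∀ s → 3 ℕ.* s ℕ.+ 3 ℕ.* s ≡ 6 ℕ.* s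
  double = ℕ-Solver.solve-∀

mux-cost+3 : ∀ p → mux-cost p ℕ.+ 3 ≡ 3 ℕ.* 2 ^ p
mux-cost+3 zero    = refl
mux-cost+3 (suc p) = begin
  mux-cost p ℕ.+ (mux-cost p ℕ.+ 3) ℕ.+ 3    ≡⟨ regroup (mux-cost p) ⟩
  (mux-cost p ℕ.+ 3) ℕ.+ (mux-cost p ℕ.+ 3)  ≡⟨ cong (λ c → c ℕ.+ c) (mux-cost+3 p) ⟩
  3 ℕ.* 2 ^ p ℕ.+ 3 ℕ.* 2 ^ p                ≡⟨ double (2 ^ p) ⟩
  3 ℕ.* 2 ^ suc p                        ∎
  where
  open ≡-Reasoning
  regroup : ∀ c → c ℕ.+ (c ℕ.+ 3) ℕ.+ 3 ≡ (c ℕ.+ 3) ℕ.+ (c ℕ.+ 3)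
  regroup = ℕ-Solver.solve-∀
  double : ∀ t → 3 ℕ.* t ℕ.+ 3 ℕ.* t ≡ 3 ℕ.* (2 ℕ.* t)
  double = ℕ-Solver.solve-∀

q+2≤2^q : ∀ q → 2 ℕ.≤ q → q ℕ.+ 2 ℕ.≤ 2 ^ q
q+2≤2^q zero                ()
q+2≤2^q (suc zero)          (s≤s ())
q+2≤2^q (suc (suc zero))    _ = ℕP.≤-refl
q+2≤2^q (suc (suc (suc q))) _ = begin
  suc x              ≡⟨ ℕP.+-comm 1 x ⟩
  x ℕ.+ 1              ≤⟨ ℕP.+-monoʳ-≤ x (s≤s z≤n) ⟩
  2 ℕ.* x              ≤⟨ ℕP.*-monoʳ-≤ 2 (q+2≤2^q (suc (suc q)) (s≤s (s≤s z≤n))) ⟩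
  2 ^ suc (suc (suc q)) ∎
  where
  open ℕP.≤-Reasoning
  x = suc (suc q) ℕ.+ 2

-- With 2^(q+1) ≤ k < 2^(q+2), the 2^(2^(q+1)) ≤ 2ᵏ table pairs and the 3 · 2^p ≤ 12 · 2ᵏ / k
-- multiplexer gates both cost O(2ᵏ / k).
cost-bound : ∀ p q → 2 ℕ.≤ q → 2 ^ suc q ℕ.≤ p ℕ.+ q → p ℕ.+ q ℕ.< 2 ^ suc (suc q) →
             (p ℕ.+ q) ℕ.* (tables-cost q ℕ.+ (mux-cost p ℕ.+ 1)) ℕ.≤ 18 ℕ.* 2 ^ (p ℕ.+ q)
cost-bound p q 2≤q lower upper = begin
  k ℕ.* (tables-cost q ℕ.+ (mux-cost p ℕ.+ 1))     ≡⟨ ℕP.*-distribˡ-+ k (tables-cost q) (mux-cost p ℕ.+ 1) ⟩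
  k ℕ.* tables-cost q ℕ.+ k ℕ.* (mux-cost p ℕ.+ 1)   ≤⟨ ℕP.+-mono-≤ tables-part mux-part ⟩
  6 ℕ.* 2 ^ k ℕ.+ 12 ℕ.* 2 ^ k                     ≡⟨ sum (2 ^ k) ⟩
  18 ℕ.* 2 ^ k                                 ∎
  where
  open ℕP.≤-Reasoning
  k = p ℕ.+ q
  sum : ∀ t → 6 ℕ.* t ℕ.+ 12 ℕ.* t ≡ 18 ℕ.* t
  sum = ℕ-Solver.solve-∀
  k≤tables : k ℕ.≤ tables q
  k≤tables = begin
    k                 ≤⟨ ℕP.<⇒≤ upper ⟩
    2 ^ suc (suc q)   ≡⟨ cong (2 ^_) (ℕP.+-comm 2 q) ⟩
    2 ^ (q ℕ.+ 2)       ≤⟨ ℕP.^-monoʳ-≤ 2 (q+2≤2^q q 2≤q) ⟩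
    2 ^ 2 ^ q         ≡⟨ tables≡ q ⟨
    tables q          ∎
  tables²≤ : tables q ℕ.* tables q ℕ.≤ 2 ^ k
  tables²≤ = ℕP.≤-trans (ℕP.≤-reflexive (tables≡ (suc q))) (ℕP.^-monoʳ-≤ 2 lower)
  tables-part : k ℕ.* tables-cost q ℕ.≤ 6 ℕ.* 2 ^ k
  tables-part = begin
    k ℕ.* tables-cost q         ≤⟨ ℕP.*-monoʳ-≤ k (tables-cost-≤ q) ⟩
    k ℕ.* (6 ℕ.* tables q)        ≡⟨ swap k (tables q) ⟩
    6 ℕ.* (k ℕ.* tables q)        ≤⟨ ℕP.*-monoʳ-≤ 6 (ℕP.≤-trans (ℕP.*-monoˡ-≤ (tables q) k≤tables) tables²≤) ⟩
    6 ℕ.* 2 ^ k                 ∎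
    where
    swap : ∀ k t → k ℕ.* (6 ℕ.* t) ≡ 6 ℕ.* (k ℕ.* t)
    swap = ℕ-Solver.solve-∀
  mux-part : k ℕ.* (mux-cost p ℕ.+ 1) ℕ.≤ 12 ℕ.* 2 ^ k
  mux-part = begin
    k ℕ.* (mux-cost p ℕ.+ 1)                     ≤⟨ ℕP.*-monoʳ-≤ k (ℕP.+-monoʳ-≤ (mux-cost p) (s≤s (z≤n {2}))) ⟩
    k ℕ.* (mux-cost p ℕ.+ 3)                     ≡⟨ cong (k ℕ.*_) (mux-cost+3 p) ⟩
    k ℕ.* (3 ℕ.* 2 ^ p)                          ≤⟨ ℕP.*-monoˡ-≤ (3 ℕ.* 2 ^ p) (ℕP.<⇒≤ upper) ⟩
    2 ℕ.* (2 ℕ.* 2 ^ q) ℕ.* (3 ℕ.* 2 ^ p)            ≡⟨ regroup (2 ^ p) (2 ^ q) ⟩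
    12 ℕ.* (2 ^ p ℕ.* 2 ^ q)                     ≡⟨ cong (12 ℕ.*_) (ℕP.^-distribˡ-+-* 2 p q) ⟨
    12 ℕ.* 2 ^ k                               ∎
    where
    regroup : ∀ a b → 2 ℕ.* (2 ℕ.* b) ℕ.* (3 ℕ.* a) ≡ 12 ℕ.* (a ℕ.* b)
    regroup = ℕ-Solver.solve-∀

log₂-bounds : ∀ k → Σ ℕ λ e → 2 ^ e ℕ.≤ suc k × suc k ℕ.< 2 ^ suc e
log₂-bounds zero    = 0 , ℕP.≤-refl , s≤s (s≤s z≤n)
log₂-bounds (suc k) with log₂-bounds k
... | e , lower , upper with suc (suc k) ℕ.<? 2 ^ suc e
...   | yes upper′ = e , ℕP.m≤n⇒m≤1+n lower , upper′
...   | no  upper̸  = suc e , ℕP.≤-reflexive (sym edge) ,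
                     subst (ℕ._< 2 ^ suc (suc e)) (sym edge) (ℕP.^-monoʳ-< 2 (s≤s (s≤s z≤n)) (ℕP.n<1+n (suc e)))
  where
  edge : suc (suc k) ≡ 2 ^ suc e
  edge = ℕP.≤-antisym upper (ℕP.≮⇒≥ upper̸)

address-split : ∀ k → 12 ℕ.≤ k → Σ ℕ λ p → Σ ℕ λ q → p ℕ.+ q ≡ k × 2 ℕ.≤ q × 2 ^ suc q ℕ.≤ k × k ℕ.< 2 ^ suc (suc q)
address-split (suc k) 12≤k with log₂-bounds k
... | zero , _ , upper                = ⊥-elim (ℕP.<⇒≱ upper (ℕP.≤-trans (ℕP.m≤m+n 2 10) 12≤k))
... | suc zero , _ , upper            = ⊥-elim (ℕP.<⇒≱ upper (ℕP.≤-trans (ℕP.m≤m+n 4 8) 12≤k))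
... | suc (suc zero) , _ , upper      = ⊥-elim (ℕP.<⇒≱ upper (ℕP.≤-trans (ℕP.m≤m+n 8 4) 12≤k))
... | suc q@(suc (suc _)) , lower , upper = suc k ℕ.∸ q , q , ℕP.m∸n+n≡m q≤k , s≤s (s≤s z≤n) , lower , upper
  where
  q≤k : q ℕ.≤ suc k
  q≤k = ℕP.≤-trans (ℕP.m≤m+n q 2) (ℕP.≤-trans (q+2≤2^q q (s≤s (s≤s z≤n))) (ℕP.≤-trans (ℕP.^-monoʳ-≤ 2 (ℕP.n≤1+n q)) lower))

-- The size bound and the choice of the prefix length

fromℕ-≤⇒ : ∀ c (B : ℚ) → fromℕ c ≤ B → c ℕ.* ↧ₙ B ℕ.≤ ℤ.∣ ↥ B ∣
fromℕ-≤⇒ c B c≤B = ℤP.drop‿+≤+ (subst (ℤ.+ (c ℕ.* ↧ₙ B) ℤ.≤_) (sym (ℤP.0≤i⇒+∣i∣≡i 0≤↥B)) c↧B≤↥B)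
  where
  c↧B≤↥B : ℤ.+ (c ℕ.* ↧ₙ B) ℤ.≤ ↥ B
  c↧B≤↥B = subst₂ ℤ._≤_ (sym (ℤP.pos-* c (↧ₙ B))) (ℤP.*-identityʳ (↥ B))
                   (ℚP.drop-*≤* (subst (_≤ B) (fromℕ≡mkℚ c) c≤B))
  0≤↥B : ℤ.0ℤ ℤ.≤ ↥ B
  0≤↥B = ℤP.≤-trans (ℤ.+≤+ z≤n) c↧B≤↥B

fromℕ-^ : ∀ a e → fromℕ a ^ℚ e ≡ fromℕ (a ^ e)
fromℕ-^ a zero    = refl
fromℕ-^ a (suc e) = trans (cong (fromℕ a *_) (fromℕ-^ a e)) (sym (fromℕ-* a (a ^ e)))

^ℚ-nonneg : ∀ {a} e → 0ℚ ≤ a → 0ℚ ≤ a ^ℚ e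
^ℚ-nonneg zero    0≤a = ℚP.<⇒≤ (ℚP.positive⁻¹ 1ℚ)
^ℚ-nonneg (suc e) 0≤a = *-nonneg 0≤a (^ℚ-nonneg e 0≤a)

^ℚ-mono-≤ : ∀ {a b} e → 0ℚ ≤ a → a ≤ b → a ^ℚ e ≤ b ^ℚ e
^ℚ-mono-≤ zero    0≤a a≤b = ℚP.≤-refl
^ℚ-mono-≤ (suc e) 0≤a a≤b = *-mono-≤ 0≤a a≤b (^ℚ-nonneg e 0≤a) (^ℚ-mono-≤ e 0≤a a≤b)

mul-log₂-≤ : ∀ d A B k → 0ℚ ≤ A → A ≤ fromℕ (2 ^ k) → fromℕ (k ℕ.* d) ≤ B → MulLog2≤ d A B
mul-log₂-≤ d A B k 0≤A A≤2^k kd≤B = begin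
  (A ^ℚ d) ^ℚ den                   ≤⟨ ^ℚ-mono-≤ den (^ℚ-nonneg d 0≤A) (^ℚ-mono-≤ d 0≤A A≤2^k) ⟩
  (fromℕ (2 ^ k) ^ℚ d) ^ℚ den       ≡⟨ trans (cong (_^ℚ den) (fromℕ-^ (2 ^ k) d)) (fromℕ-^ ((2 ^ k) ^ d) den) ⟩
  fromℕ (((2 ^ k) ^ d) ^ den)       ≡⟨ cong fromℕ (trans (ℕP.^-*-assoc (2 ^ k) d den) (ℕP.^-*-assoc 2 k (d ℕ.* den))) ⟩
  fromℕ (2 ^ (k ℕ.* (d ℕ.* den)))   ≤⟨ fromℕ-mono-≤ (ℕP.^-monoʳ-≤ 2 (subst (ℕ._≤ num) (ℕP.*-assoc k d den) (fromℕ-≤⇒ (k ℕ.* d) B kd≤B))) ⟩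
  fromℕ (2 ^ num)                   ≡⟨ fromℕ-^ 2 num ⟨
  fromℕ 2 ^ℚ num                    ∎
  where
  open ℚP.≤-Reasoning
  den = ↧ₙ B
  num = ℤ.∣ ↥ B ∣

power-of-two-window : ∀ (a : ℚ) → 1ℚ < a → ∀ j →
  fromℕ (2 ^ j) < a ⊎ Σ ℕ λ k → k ℕ.≤ j × a ≤ fromℕ (2 ^ k) × fromℕ (2 ^ k) ≤ fromℕ 2 * a
power-of-two-window a 1<a zero = inj₁ 1<a
power-of-two-window a 1<a (suc j) with power-of-two-window a 1<a j
... | inj₂ (k , k≤j , a≤2^k , 2^k≤2a) = inj₂ (k , ℕP.m≤n⇒m≤1+n k≤j , a≤2^k , 2^k≤2a)
... | inj₁ 2^j<a with a ℚP.≤? fromℕ (2 ^ suc j)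
...   | no  a≰2^j+1 = inj₁ (ℚP.≰⇒> a≰2^j+1)
...   | yes a≤2^j+1 = inj₂ (suc j , ℕP.≤-refl , a≤2^j+1 ,
          subst (_≤ fromℕ 2 * a) (sym (fromℕ-* 2 (2 ^ j))) (*-monoˡ-≤ (fromℕ-nonneg 2) (ℚP.<⇒≤ 2^j<a)))

SmallCircuits : ∀ {n m} → (BitStr m → BitStr n → Bool) → ℕ → Set
SmallCircuits {n} G r = ∀ s → Σ (Circuit n) λ Cₛ → Circuit.size Cₛ ℕ.≤ r × Computes Cₛ (G s)

circuit-from-correction : ∀ {m r} p q l (H : Distribution ((p ℕ.+ q) ℕ.+ l)) f G γ →
  SmallCircuits G r → Correction {p ℕ.+ q} {l} {m} H f G γ →
  Σ (Circuit ((p ℕ.+ q) ℕ.+ l)) λ C → Circuit.size C ℕ.≤ r ℕ.+ (tables-cost q ℕ.+ (mux-cost p ℕ.+ 1))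
                                      × ½ + γ ≤ PrAgree H C f
circuit-from-correction {m} {r} p q l H f G γ circuits (s , σ , good)
  with circuits s | prefix-inputs (p ℕ.+ q) l
... | Cₛ , Cₛ-size≤r , Cₛ-computes | ws , ws-available , values≡take
  with Construction.correction-circuit ((p ℕ.+ q) ℕ.+ l) p q ws ws-available σ Cₛ Cₛ-computes
...   | C , size≤ , eval≡ = C , ℕP.≤-trans size≤ (ℕP.+-monoˡ-≤ _ Cₛ-size≤r) ,
                            ℚP.≤-trans good (ℚP.≤-reflexive (agreement-cong H f computes))
  where
  computes : ∀ x → G s x xor σ (take (p ℕ.+ q) x) ≡ eval C x
  computes x = sym (trans (eval≡ x) (cong (λ v → G s x xor σ v) (values≡take x)))

-- Either blocks of 2^l points are small enough for the moment argument, or there is one point per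
-- block and f itself is reachable.
Regime : ℕ → ℚ → Set
Regime l γ = fromℕ 12 * (γ * γ) * fromℕ (2 ^ l) ≤ 1ℚ ⊎ (l ≡ 0 × γ ≤ ½)

correction-in-regime : ∀ {k l m} f (G : BitStr m → BitStr (k ℕ.+ l) → Bool) (H : Distribution (k ℕ.+ l)) γ →
  KWiseUniformGen 4 m G → 3 ℕ.≤ k ℕ.+ l → Regime l γ → Correction {k} {l} H f G γ
correction-in-regime f G H γ uniform 3≤n (inj₁ small)        = BlockCorrection.block-correction f G uniform 3≤n H γ small
correction-in-regime f G H γ uniform 3≤n (inj₂ (refl , γ≤½)) = exact-correction H f G γ γ≤½

circuit-for-address-split : ∀ {n m r} p q l → (p ℕ.+ q) ℕ.+ l ≡ n → (f : BitStr n → Bool) (H : Distribution n)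
  (G : BitStr m → BitStr n → Bool) (γ A : ℚ) → KWiseUniformGen 4 m G → SmallCircuits G r → Regime l γ →
  2 ℕ.≤ q → 2 ^ suc q ℕ.≤ p ℕ.+ q → p ℕ.+ q ℕ.< 2 ^ suc (suc q) →
  0ℚ ≤ A → A ≤ fromℕ (2 ^ (p ℕ.+ q)) → fromℕ (2 ^ (p ℕ.+ q)) ≤ fromℕ 24 * A →
  Σ (Circuit n) λ C → SizeBound 432 A r (Circuit.size C) × ½ + γ ≤ PrAgree H C f
circuit-for-address-split {r = r} p q l refl f H G γ A uniform circuits regime 2≤q lower upper 0≤A A≤2^k 2^k≤24A
  with circuit-from-correction p q l H f G γ circuits (correction-in-regime f G H γ uniform 3≤n regime)
  where
  3≤n : 3 ℕ.≤ (p ℕ.+ q) ℕ.+ l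
  3≤n = ℕP.≤-trans (ℕP.m≤m+n 3 5) (ℕP.≤-trans (ℕP.^-monoʳ-≤ 2 (s≤s 2≤q)) (ℕP.≤-trans lower (ℕP.m≤m+n (p ℕ.+ q) l)))
... | C , size≤ , agrees = C , mul-log₂-≤ d A (fromℕ 432 * A) k 0≤A A≤2^k scaled-cost , agrees
  where
  open ℚP.≤-Reasoning
  k = p ℕ.+ q
  cost = tables-cost q ℕ.+ (mux-cost p ℕ.+ 1)
  d = Circuit.size C ∸ 432 ℕ.* r
  d≤cost : d ℕ.≤ cost
  d≤cost = ℕP.m≤n+o⇒m∸n≤o (Circuit.size C) (432 ℕ.* r) (ℕP.≤-trans size≤ (ℕP.+-monoˡ-≤ cost (ℕP.m≤n*m r 432)))
  scaled-cost : fromℕ (k ℕ.* d) ≤ fromℕ 432 * A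
  scaled-cost = begin
    fromℕ (k ℕ.* d)            ≤⟨ fromℕ-mono-≤ (ℕP.≤-trans (ℕP.*-monoʳ-≤ k d≤cost) (cost-bound p q 2≤q lower upper)) ⟩
    fromℕ (18 ℕ.* 2 ^ k)       ≡⟨ fromℕ-* 18 (2 ^ k) ⟩
    fromℕ 18 * fromℕ (2 ^ k)   ≤⟨ *-monoˡ-≤ (fromℕ-nonneg 18) 2^k≤24A ⟩
    fromℕ 18 * (fromℕ 24 * A)  ≡⟨ ℚP.*-assoc (fromℕ 18) (fromℕ 24) A ⟨
    fromℕ 432 * A              ∎

1<12A : ∀ A → fromℕ 729 < A → 1ℚ < fromℕ 12 * A
1<12A A 729<A = ℚP.≤-<-trans (fromℕ-mono-≤ {1} {12 ℕ.* 729} (s≤s z≤n))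
                  (subst (_< fromℕ 12 * A) (sym (fromℕ-* 12 729)) (ℚP.*-monoʳ-<-pos (fromℕ 12) 729<A))

0≤A : ∀ {A} → fromℕ 729 < A → 0ℚ ≤ A
0≤A 729<A = ℚP.<⇒≤ (ℚP.≤-<-trans (fromℕ-nonneg 729) 729<A)

fromℕ-*-mono-≤ : ∀ {a b} A → a ℕ.≤ b → 0ℚ ≤ A → fromℕ a * A ≤ fromℕ b * A
fromℕ-*-mono-≤ A a≤b 0≤A = *-monoʳ-≤ 0≤A (fromℕ-mono-≤ a≤b)

small-γ : ∀ γ N → 0ℚ < γ → γ ≤ ½ → fromℕ 4 * (γ * γ * fromℕ N) ≤ fromℕ N
small-γ γ N 0<γ γ≤½ = begin
  fromℕ 4 * (γ * γ * fromℕ N)   ≡⟨ ℚP.*-assoc (fromℕ 4) (γ * γ) (fromℕ N) ⟨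
  fromℕ 4 * (γ * γ) * fromℕ N   ≤⟨ *-monoʳ-≤ (fromℕ-nonneg N) (*-monoˡ-≤ (fromℕ-nonneg 4) (*-mono-≤ 0≤γ γ≤½ 0≤γ γ≤½)) ⟩
  fromℕ 4 * (½ * ½) * fromℕ N   ≡⟨ ℚP.*-identityˡ (fromℕ N) ⟩
  fromℕ N                       ∎
  where
  open ℚP.≤-Reasoning
  0≤γ = ℚP.<⇒≤ 0<γ

block-regime : ∀ {n} k l γ → k ℕ.+ l ≡ n → fromℕ 12 * (γ * γ * fromℕ (2 ^ n)) ≤ fromℕ (2 ^ k) →
               fromℕ 12 * (γ * γ) * fromℕ (2 ^ l) ≤ 1ℚ
block-regime k l γ refl 12A≤2^k = *-cancelʳ-≤ (fromℕ (2 ^ k)) (fromℕ-mono-< {0} (ℕP.m^n>0 2 k)) (begin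
  fromℕ 12 * (γ * γ) * fromℕ (2 ^ l) * fromℕ (2 ^ k)     ≡⟨ regroup (fromℕ 12) (γ * γ) (fromℕ (2 ^ k)) (fromℕ (2 ^ l)) ⟩
  fromℕ 12 * (γ * γ * (fromℕ (2 ^ k) * fromℕ (2 ^ l)))   ≡⟨ cong (λ t → fromℕ 12 * (γ * γ * t)) (fromℕ-* (2 ^ k) (2 ^ l)) ⟨
  fromℕ 12 * (γ * γ * fromℕ (2 ^ k ℕ.* 2 ^ l))           ≡⟨ cong (λ t → fromℕ 12 * (γ * γ * fromℕ t)) (ℕP.^-distribˡ-+-* 2 k l) ⟨
  fromℕ 12 * (γ * γ * fromℕ (2 ^ (k ℕ.+ l)))             ≤⟨ 12A≤2^k ⟩
  fromℕ (2 ^ k)                                          ≡⟨ ℚP.*-identityˡ (fromℕ (2 ^ k)) ⟨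
  1ℚ * fromℕ (2 ^ k)                                     ∎)
  where
  open ℚP.≤-Reasoning
  regroup : ∀ c g a b → c * g * b * a ≡ c * (g * (a * b))
  regroup = solve-∀ ℚ-ring

exponent-≥12 : ∀ k A → fromℕ 729 < A → fromℕ 4 * A ≤ fromℕ (2 ^ k) → 12 ℕ.≤ k
exponent-≥12 k A 729<A 4A≤2^k with 12 ℕ.≤? k
... | yes 12≤k = 12≤k
... | no  12≰k = ⊥-elim (ℕP.<⇒≱ (ℕP.<-≤-trans 2^k>2916 (ℕP.^-monoʳ-≤ 2 (ℕP.≤-pred (ℕP.≰⇒> 12≰k)))) (ℕP.m≤m+n 2048 868))
  where
  2^k>2916 : 2916 ℕ.< 2 ^ k
  2^k>2916 = fromℕ-cancel-< (ℚP.<-≤-trans (subst (_< fromℕ 4 * A) (sym (fromℕ-* 4 729))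
                                             (ℚP.*-monoʳ-<-pos (fromℕ 4) 729<A)) 4A≤2^k)

circuit-for-prefix-length : ∀ {n m r} k l → k ℕ.+ l ≡ n → (f : BitStr n → Bool) (H : Distribution n)
  (G : BitStr m → BitStr n → Bool) (γ A : ℚ) → KWiseUniformGen 4 m G → SmallCircuits G r → Regime l γ →
  fromℕ 729 < A → fromℕ 4 * A ≤ fromℕ (2 ^ k) → fromℕ (2 ^ k) ≤ fromℕ 24 * A →
  Σ (Circuit n) λ C → SizeBound 432 A r (Circuit.size C) × ½ + γ ≤ PrAgree H C f
circuit-for-prefix-length k l k+l≡n f H G γ A uniform circuits regime 729<A 4A≤2^k 2^k≤24A
  with address-split k (exponent-≥12 k A 729<A 4A≤2^k)
... | p , q , refl , 2≤q , lower , upper =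
  circuit-for-address-split p q l k+l≡n f H G γ A uniform circuits regime 2≤q lower upper (0≤A 729<A) A≤2^k 2^k≤24A
  where
  A≤2^k : A ≤ fromℕ (2 ^ (p ℕ.+ q))
  A≤2^k = ℚP.≤-trans (subst (_≤ fromℕ 4 * A) (ℚP.*-identityˡ A) (fromℕ-*-mono-≤ {1} {4} A (s≤s z≤n) (0≤A 729<A))) 4A≤2^k

-- Imported only here: with ℤ's +_ in scope, the sections (x +_) above would be ambiguous.
open import Data.Integer using (+_)

lemma3p1 : Σ ℕ λ K → 1 ℕ.≤ K ×
    (∀ (n : ℕ) (f : BitStr n → Bool) (H : Distribution n) (γ : ℚ)
       (m r : ℕ) (G : BitStr m → BitStr n → Bool) →
       0ℚ < γ →
       (+ 729 / 1) < γ * γ * (+ (2 ^ n) / 1) →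
       γ < + 1 / 2 →
       KWiseUniformGen 4 m G →
       (∀ s → Σ (Circuit n) λ Cₛ → Circuit.size Cₛ ℕ.≤ r × Computes Cₛ (G s)) →
       Σ (Circuit n) λ C →
         SizeBound K (γ * γ * (+ (2 ^ n) / 1)) r (Circuit.size C) ×
         (+ 1 / 2 + γ) ≤ PrAgree H C f)
lemma3p1 = 432 , s≤s z≤n , λ n f H γ m r G 0<γ 729<A γ<½ uniform circuits →
  let A = γ * γ * fromℕ (2 ^ n) in
  case power-of-two-window (fromℕ 12 * A) (1<12A A 729<A) n of λ where
    (inj₁ 2^n<12A) →
      circuit-for-prefix-length n 0 (ℕP.+-identityʳ n) f H G γ A uniform circuits (inj₂ (refl , ℚP.<⇒≤ γ<½)) 729<A
        (small-γ γ (2 ^ n) 0<γ (ℚP.<⇒≤ γ<½))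
        (ℚP.≤-trans (ℚP.<⇒≤ 2^n<12A) (fromℕ-*-mono-≤ A (ℕP.m≤m+n 12 12) (0≤A 729<A)))
    (inj₂ (k , k≤n , 12A≤2^k , 2^k≤24A)) →
      circuit-for-prefix-length k (n ∸ k) (ℕP.m+[n∸m]≡n k≤n) f H G γ A uniform circuits
        (inj₁ (block-regime k (n ∸ k) γ (ℕP.m+[n∸m]≡n k≤n) 12A≤2^k)) 729<A
        (ℚP.≤-trans (fromℕ-*-mono-≤ A (ℕP.m≤m+n 4 8) (0≤A 729<A)) 12A≤2^k)
        (subst (fromℕ (2 ^ k) ≤_) (sym (ℚP.*-assoc (fromℕ 2) (fromℕ 12) A)) 2^k≤24A)
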